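{- Let $C_{<i}(z)=\sum_{j=0}^{i-1}C_jz^j$ and for $n\ge0$ let $K'_n=(x-q)C_nz^n+(1-q)C_{<n}(z)$. Then $$F_{231}(x,q,z)=\cfrac{1}{1-zK'_0-\cfrac{qz}{1-zK'_1-\cfrac{qz}{1-zK'_2-\cfrac{qz}{1-zK'_3-\cfrac{qz}{\ddots}}}}}.$$
   Context: For permutations $\pi=\pi_1\cdots\pi_n\in\mathfrak{S}_n$ and $\sigma\in\mathfrak{S}_m$, $\pi$ contains $\sigma$ if there are indices $i_1<\dots<i_m$ such that $\pi_{i_1}\cdots\pi_{i_m}$ is in the same relative order as $\sigma$; otherwise $\pi$ avoids $\sigma$. $\mathfrak{S}_n(231)$ is the set of $231$-avoiding permutations in $\mathfrak{S}_n$. $\mathrm{fp}(\pi)=|\{i:\pi_i=i\}|$, $\mathrm{exc}(\pi)=|\{i:\pi_i>i\}|$, and $F_{231}(x,q,z)=\sum_{n\ge0}\sum_{\pi\in\mathfrak{S}_n(231)}x^{\mathrm{fp}(\pi)}q^{\mathrm{exc}(\pi)}z^n$. $C_n=\frac{1}{n+1}\binom{2n}{n}$. -}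

module Defs where

open import Data.Nat as ℕ using (ℕ; zero; suc; _<ᵇ_; _≡ᵇ_; _/_; _∸_)
open import Data.Nat.Combinatorics using (_C_)
open import Data.Bool using (Bool; true; false; _∧_; _∨_; if_then_else_)
open import Data.Bool.ListAction using (any)
open import Data.List using (List; []; _∷_; concatMap; map; filterᵇ; length)
open import Data.Integer as ℤ using (ℤ; +_; -_)

-- Permutations of [1..n] as lists of values (one-line notation π₁⋯πₙ)

insertions : ℕ → List ℕ → List (List ℕ)
insertions x []       = (x ∷ []) ∷ []
insertions x (y ∷ ys) = (x ∷ y ∷ ys) ∷ map (y ∷_) (insertions x ys)

perms : ℕ → List (List ℕ)
perms zero    = [] ∷ []
perms (suc n) = concatMap (insertions (suc n)) (perms n)

has31after : ℕ → List ℕ → Bool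
has31after a []       = false
has31after a (b ∷ bs) = ((a <ᵇ b) ∧ any (λ c → c <ᵇ a) bs) ∨ has31after a bs

-- π contains 231: indices i<j<k with π_k < π_i < π_j
contains231 : List ℕ → Bool
contains231 []       = false
contains231 (a ∷ as) = has31after a as ∨ contains231 as

avoids231 : List ℕ → Bool
avoids231 π = if contains231 π then false else true

S231 : ℕ → List (List ℕ)
S231 n = filterᵇ avoids231 (perms n)

fpFrom : ℕ → List ℕ → ℕ
fpFrom i []       = 0
fpFrom i (v ∷ vs) = (if v ≡ᵇ i then 1 else 0) ℕ.+ fpFrom (suc i) vs

excFrom : ℕ → List ℕ → ℕ
excFrom i []       = 0
excFrom i (v ∷ vs) = (if i <ᵇ v then 1 else 0) ℕ.+ excFrom (suc i) vs

fp exc : List ℕ → ℕ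
fp  = fpFrom 1
exc = excFrom 1

-- Formal power series in z, x, q with integer coefficients:
-- s n a b is the coefficient of z^n x^a q^b.

Series : Set
Series = ℕ → ℕ → ℕ → ℤ

F231 : Series
F231 n a b = + length (filterᵇ (λ π → (fp π ≡ᵇ a) ∧ (exc π ≡ᵇ b)) (S231 n))

sumTo : ℕ → (ℕ → ℤ) → ℤ
sumTo zero    f = f 0
sumTo (suc n) f = sumTo n f ℤ.+ f (suc n)

zeroS oneS : Series
zeroS n a b = + 0
oneS zero zero zero = + 1
oneS _    _    _    = + 0

_⊕_ : Series → Series → Series
(f ⊕ g) n a b = f n a b ℤ.+ g n a b

_⊗_ : Series → Series → Series
(f ⊗ g) n a b =
  sumTo n λ i → sumTo a λ j → sumTo b λ k →
    f i j k ℤ.* g (n ∸ i) (a ∸ j) (b ∸ k)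

zS qS : Series → Series
zS f zero    a b = + 0
zS f (suc n) a b = f n a b
qS f n a zero    = + 0
qS f n a (suc b) = f n a b

powS : Series → ℕ → Series
powS g zero    = oneS
powS g (suc m) = g ⊗ powS g m

-- 1/(1 - g) = Σ_m g^m, valid for g with no z^0 term
-- (then only m ≤ n contributes to the coefficient of z^n)
geom : Series → Series
geom g n a b = sumTo n λ m → powS g m n a b

catalan : ℕ → ℕ
catalan n = ((2 ℕ.* n) C n) / suc n

-- K'_i = (x - q) C_i z^i + (1 - q) Σ_{j<i} C_j z^j
K' : ℕ → Series
K' i m a b with ℕ.compare m i
K' i m a b | ℕ.equal _ with a | b
... | 1 | 0 = + catalan i
... | 0 | 1 = - (+ catalan i)
... | _ | _ = + 0
K' i m a b | ℕ.less _ _ with a | b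
... | 0 | 0 = + catalan m
... | 0 | 1 = - (+ catalan m)
... | _ | _ = + 0
K' i m a b | ℕ.greater _ _ = + 0

-- Truncation of the continued fraction at depth d, starting at level i:
--   CF 0 i       = 1 / (1 - z K'_i)
--   CF (d+1) i   = 1 / (1 - z K'_i - q z · CF d (i+1))
CF : ℕ → ℕ → Series
CF zero    i = geom (zS (K' i))
CF (suc d) i = geom (zS (K' i) ⊕ zS (qS (CF d (suc i))))

-- Let G_s count 231-avoiders by z^n x^fp q^exc where position i is compared with i + s, so that
-- F_231 = G_0.  A 231-avoider of size n+1 is uniquely α (n+1) β', where α avoids 231 and has size
-- n-m, and β' is a 231-avoider β of size m with every entry raised by n-m.  Seen with shift s, the
-- entries of α keep their positions, the maximum is a fixed point iff m = s and an excedance iff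
-- m > s, and β is seen with shift s+1; when m ≤ s the entries of β are below their positions and
-- there are C_m of them.  Hence G_s = 1 + z (K'_s + q G_{s+1}) G_s.  This recursion determines the
-- coefficient of z^n from lower ones, so the continued fraction truncated at depth d agrees with
-- G_0 up to z^d.  The same decomposition gives the Catalan recurrence for the number of avoiders.

module Submission where

open import Defs
open import Data.Nat as ℕ using (ℕ; zero; suc; _≤_; _<_; z≤n; s≤s; _∸_; _≡ᵇ_; _<ᵇ_)
import Data.Nat.Properties as ℕₚ
open import Data.Nat.Induction using (<-rec)
open import Data.Nat.Tactic.RingSolver using (solve-∀)
open import Data.Nat.Combinatorics using (_C_; nCk+nC[k+1]≡[n+1]C[k+1]; k>n⇒nCk≡0; nC1≡n; nCk≡nC[n∸k])
open import Data.Nat.DivMod using (_/_; m*n/n≡m)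
open import Data.Integer using (ℤ; +_; -_; 0ℤ; _+_; _*_)
import Data.Integer.Properties as ℤₚ
open import Algebra.Properties.CommutativeSemigroup ℤₚ.+-commutativeSemigroup
  using () renaming (interchange to +-interchange)
open import Algebra.Properties.CommutativeSemigroup ℤₚ.*-commutativeSemigroup
  using () renaming (interchange to *-interchange)
open import Data.Bool using (Bool; true; false; T; _∧_; _∨_; if_then_else_)
open import Data.Bool.Properties using (T?; ∨-conicalˡ; ∨-conicalʳ; ∨-identityʳ; ∨-assoc; ∧-zeroʳ)
open import Data.Bool.ListAction using (any)
open import Relation.Nullary.Decidable using (dec-true; dec-false)
open import Data.Sum using (inj₁; inj₂)
open import Data.Product using (∃; ∃₂; _×_; _,_; proj₁; proj₂)
import Data.Product as Product
open import Data.Empty using (⊥-elim)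
open import Function using (_∘_)
open import Data.List using (List; []; _∷_; _++_; [_]; map; concatMap; length; filterᵇ; applyUpTo; upTo)
import Data.List.Properties as Listₚ
open import Data.List.Membership.Propositional using (_∈_; _∉_; find; lose)
open import Data.List.Membership.Propositional.Properties
  using ( ∈-++⁺ˡ; ∈-++⁺ʳ; ∈-++⁻; ∈-map⁺; ∈-map⁻; map∷⁻; ∈-concatMap⁺; ∈-concatMap⁻; ∈-∃++
        ; ∈-filter⁺; ∈-filter⁻; ∈-upTo⁺; ∈-upTo⁻)
open import Data.List.Membership.Propositional.Properties.WithK using (unique∧set⇒bag)
open import Data.List.Relation.Binary.BagAndSetEquality using (∼bag⇒↭)
open import Function.Bundles using (mk⇔)
open import Data.List.Relation.Unary.Any using (here; there)
open import Data.List.Relation.Unary.All as All using (All; []; _∷_)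
open import Data.List.Relation.Unary.Unique.Propositional using (Unique; []; _∷_)
import Data.List.Relation.Unary.Unique.Propositional.Properties as Uniqueₚ
open import Data.List.Relation.Binary.Permutation.Propositional
  using (_↭_; ↭-refl; ↭-prep; ↭-trans; ↭-sym; ↭⇒↭ₛ)
import Data.List.Relation.Binary.Permutation.Setoid.Properties as ↭ₛₚ
import Data.List.Relation.Binary.Permutation.Propositional.Properties as ↭ₚ
open import Relation.Binary.PropositionalEquality hiding ([_])

sumTo-cong : ∀ n {f g : ℕ → ℤ} → (∀ i → i ≤ n → f i ≡ g i) → sumTo n f ≡ sumTo n g
sumTo-cong zero    f≗g = f≗g 0 z≤n
sumTo-cong (suc n) f≗g =
  cong₂ _+_ (sumTo-cong n (λ i i≤n → f≗g i (ℕₚ.m≤n⇒m≤1+n i≤n))) (f≗g (suc n) ℕₚ.≤-refl)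

sumTo-≡0 : ∀ n {f : ℕ → ℤ} → (∀ i → i ≤ n → f i ≡ 0ℤ) → sumTo n f ≡ 0ℤ
sumTo-≡0 zero    f≗0 = f≗0 0 z≤n
sumTo-≡0 (suc n) f≗0 =
  cong₂ _+_ (sumTo-≡0 n (λ i i≤n → f≗0 i (ℕₚ.m≤n⇒m≤1+n i≤n))) (f≗0 (suc n) ℕₚ.≤-refl)

sumTo-+ : ∀ n (f g : ℕ → ℤ) → sumTo n (λ i → f i + g i) ≡ sumTo n f + sumTo n g
sumTo-+ zero    f g = refl
sumTo-+ (suc n) f g =
  trans (cong (_+ (f (suc n) + g (suc n))) (sumTo-+ n f g))
        (+-interchange (sumTo n f) (sumTo n g) (f (suc n)) (g (suc n)))

*-distribˡ-sumTo : ∀ n (c : ℤ) (f : ℕ → ℤ) → c * sumTo n f ≡ sumTo n (λ i → c * f i)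
*-distribˡ-sumTo zero    c f = refl
*-distribˡ-sumTo (suc n) c f =
  trans (ℤₚ.*-distribˡ-+ c (sumTo n f) (f (suc n))) (cong (_+ c * f (suc n)) (*-distribˡ-sumTo n c f))

*-distribʳ-sumTo : ∀ n (c : ℤ) (f : ℕ → ℤ) → sumTo n f * c ≡ sumTo n (λ i → f i * c)
*-distribʳ-sumTo zero    c f = refl
*-distribʳ-sumTo (suc n) c f =
  trans (ℤₚ.*-distribʳ-+ c (sumTo n f) (f (suc n))) (cong (_+ f (suc n) * c) (*-distribʳ-sumTo n c f))

sumTo-*-sumTo : ∀ m n (P Q : ℕ → ℤ) →
  sumTo m P * sumTo n Q ≡ sumTo m (λ j → sumTo n (λ l → P j * Q l))
sumTo-*-sumTo m n P Q =
  trans (*-distribʳ-sumTo m (sumTo n Q) P) (sumTo-cong m (λ j _ → *-distribˡ-sumTo n (P j) Q))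

sumTo-comm : ∀ m n (h : ℕ → ℕ → ℤ) →
  sumTo m (λ i → sumTo n (λ j → h i j)) ≡ sumTo n (λ j → sumTo m (λ i → h i j))
sumTo-comm zero    n h = refl
sumTo-comm (suc m) n h =
  trans (cong (_+ sumTo n (h (suc m))) (sumTo-comm m n h))
        (sym (sumTo-+ n (λ j → sumTo m (λ i → h i j)) (h (suc m))))

sumTo-suc : ∀ n (f : ℕ → ℤ) → sumTo (suc n) f ≡ f 0 + sumTo n (λ i → f (suc i))
sumTo-suc zero    f = refl
sumTo-suc (suc n) f =
  trans (cong (_+ f (suc (suc n))) (sumTo-suc n f)) (ℤₚ.+-assoc (f 0) _ _)

sumTo-extend : ∀ {n} N (f : ℕ → ℤ) → n ≤ N → (∀ i → n < i → f i ≡ 0ℤ) → sumTo N f ≡ sumTo n f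
sumTo-extend zero    f z≤n  f≗0 = refl
sumTo-extend (suc N) f n≤1+N f≗0 with ℕₚ.m≤n⇒m<n∨m≡n n≤1+N
... | inj₂ refl      = refl
... | inj₁ (s≤s n≤N) =
  trans (cong₂ _+_ (sumTo-extend N f n≤N f≗0) (f≗0 (suc N) (s≤s n≤N))) (ℤₚ.+-identityʳ _)

sumTo-reverse : ∀ n (f : ℕ → ℤ) → sumTo n f ≡ sumTo n (λ k → f (n ∸ k))
sumTo-reverse zero    f = refl
sumTo-reverse (suc n) f = begin
  sumTo n f + f (suc n)                     ≡⟨ ℤₚ.+-comm (sumTo n f) _ ⟩
  f (suc n) + sumTo n f                     ≡⟨ cong (λ x → f (suc n) + x) (sumTo-reverse n f) ⟩
  f (suc n) + sumTo n (λ k → f (n ∸ k))     ≡⟨ sumTo-suc n (λ k → f (suc n ∸ k)) ⟨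
  sumTo (suc n) (λ k → f (suc n ∸ k))       ∎
  where open ≡-Reasoning

-- Products of power series

NoConstantTerm : Series → Set
NoConstantTerm g = ∀ a b → g 0 a b ≡ 0ℤ

infixl 7 _✶_

_✶_ : (ℕ → ℕ → ℤ) → (ℕ → ℕ → ℤ) → ℕ → ℕ → ℤ
(F ✶ H) a b = sumTo a λ j → sumTo b λ l → F j l * H (a ∸ j) (b ∸ l)

✶-cong : ∀ {F F' H H'} → (∀ j l → F j l ≡ F' j l) → (∀ j l → H j l ≡ H' j l) →
  ∀ a b → (F ✶ H) a b ≡ (F' ✶ H') a b
✶-cong F≗F' H≗H' a b =
  sumTo-cong a (λ j _ → sumTo-cong b (λ l _ → cong₂ _*_ (F≗F' j l) (H≗H' (a ∸ j) (b ∸ l))))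

✶-congˡ : ∀ {F F'} H → (∀ j l → F j l ≡ F' j l) → ∀ a b → (F ✶ H) a b ≡ (F' ✶ H) a b
✶-congˡ {F} {F'} H F≗F' = ✶-cong {F} {F'} {H} {H} F≗F' (λ _ _ → refl)

✶-congʳ : ∀ F {H H'} → (∀ j l → H j l ≡ H' j l) → ∀ a b → (F ✶ H) a b ≡ (F ✶ H') a b
✶-congʳ F {H} {H'} = ✶-cong {F} {F} {H} {H'} (λ _ _ → refl)

✶-zeroˡ : ∀ {F} H → (∀ j l → F j l ≡ 0ℤ) → ∀ a b → (F ✶ H) a b ≡ 0ℤ
✶-zeroˡ H F≗0 a b =
  sumTo-≡0 a (λ j _ → sumTo-≡0 b (λ l _ → cong (_* H (a ∸ j) (b ∸ l)) (F≗0 j l)))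

✶-zeroʳ : ∀ F {H} → (∀ j l → H j l ≡ 0ℤ) → ∀ a b → (F ✶ H) a b ≡ 0ℤ
✶-zeroʳ F H≗0 a b = sumTo-≡0 a (λ j _ → sumTo-≡0 b (λ l _ →
  trans (cong (F j l *_) (H≗0 (a ∸ j) (b ∸ l))) (ℤₚ.*-zeroʳ (F j l))))

✶-distribʳ-+ : ∀ F F' H a b → ((λ j l → F j l + F' j l) ✶ H) a b ≡ (F ✶ H) a b + (F' ✶ H) a b
✶-distribʳ-+ F F' H a b =
  trans (sumTo-cong a (λ j _ → trans (sumTo-cong b (λ l _ → ℤₚ.*-distribʳ-+ (H (a ∸ j) (b ∸ l)) (F j l) (F' j l)))
                                     (sumTo-+ b _ _)))
        (sumTo-+ a _ _)

✶-distribˡ-+ : ∀ F H H' a b → (F ✶ (λ j l → H j l + H' j l)) a b ≡ (F ✶ H) a b + (F ✶ H') a b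
✶-distribˡ-+ F H H' a b =
  trans (sumTo-cong a (λ j _ → trans (sumTo-cong b (λ l _ → ℤₚ.*-distribˡ-+ (F j l) (H (a ∸ j) (b ∸ l)) _))
                                     (sumTo-+ b _ _)))
        (sumTo-+ a _ _)

✶-sumToʳ : ∀ F N (H : ℕ → ℕ → ℕ → ℤ) a b →
  (F ✶ (λ j l → sumTo N (λ m → H m j l))) a b ≡ sumTo N (λ m → (F ✶ H m) a b)
✶-sumToʳ F N H a b = begin
  (sumTo a λ j → sumTo b λ l → F j l * sumTo N (λ m → H m (a ∸ j) (b ∸ l)))
    ≡⟨ sumTo-cong a (λ j _ → sumTo-cong b (λ l _ → *-distribˡ-sumTo N (F j l) _)) ⟩
  (sumTo a λ j → sumTo b λ l → sumTo N λ m → F j l * H m (a ∸ j) (b ∸ l))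
    ≡⟨ sumTo-cong a (λ j _ → sumTo-comm b N _) ⟩
  (sumTo a λ j → sumTo N λ m → sumTo b λ l → F j l * H m (a ∸ j) (b ∸ l))
    ≡⟨ sumTo-comm a N _ ⟩
  sumTo N (λ m → (F ✶ H m) a b) ∎
  where open ≡-Reasoning

⊗-noConstantˡ-zero : ∀ f g → NoConstantTerm f → ∀ a b → (f ⊗ g) 0 a b ≡ 0ℤ
⊗-noConstantˡ-zero f g f₀≡0 = ✶-zeroˡ (g 0) f₀≡0

⊗-noConstantˡ-suc : ∀ f g → NoConstantTerm f → ∀ n a b →
  (f ⊗ g) (suc n) a b ≡ sumTo n (λ i → (f (suc i) ✶ g (n ∸ i)) a b)
⊗-noConstantˡ-suc f g f₀≡0 n a b =
  trans (sumTo-suc n (λ i → (f i ✶ g (suc n ∸ i)) a b))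
        (trans (cong (_+ rest) (✶-zeroˡ (g (suc n)) f₀≡0 a b)) (ℤₚ.+-identityˡ rest))
  where rest = sumTo n (λ i → (f (suc i) ✶ g (n ∸ i)) a b)

⊗-cong-suc : ∀ f f' g g' → NoConstantTerm f → NoConstantTerm f' → ∀ n →
  (∀ i → i ≤ n → ∀ a b → f (suc i) a b ≡ f' (suc i) a b) →
  (∀ k → k ≤ n → ∀ a b → g k a b ≡ g' k a b) →
  ∀ a b → (f ⊗ g) (suc n) a b ≡ (f' ⊗ g') (suc n) a b
⊗-cong-suc f f' g g' f₀≡0 f'₀≡0 n f≗f' g≗g' a b = begin
  (f ⊗ g) (suc n) a b                               ≡⟨ ⊗-noConstantˡ-suc f g f₀≡0 n a b ⟩
  sumTo n (λ i → (f (suc i) ✶ g (n ∸ i)) a b)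
    ≡⟨ sumTo-cong n (λ i i≤n → ✶-cong (f≗f' i i≤n) (g≗g' (n ∸ i) (ℕₚ.m∸n≤m n i)) a b) ⟩
  sumTo n (λ i → (f' (suc i) ✶ g' (n ∸ i)) a b)     ≡⟨ ⊗-noConstantˡ-suc f' g' f'₀≡0 n a b ⟨
  (f' ⊗ g') (suc n) a b                             ∎
  where open ≡-Reasoning

module _ (g : Series) (g₀≡0 : NoConstantTerm g) where

  powS-vanish : ∀ m n a b → n < m → powS g m n a b ≡ 0ℤ
  powS-vanish (suc m) zero    a b _         = ⊗-noConstantˡ-zero g (powS g m) g₀≡0 a b
  powS-vanish (suc m) (suc n) a b (s≤s n<m) =
    trans (⊗-noConstantˡ-suc g (powS g m) g₀≡0 n a b) (sumTo-≡0 n (λ i _ →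
      ✶-zeroʳ (g (suc i)) (λ j l → powS-vanish m (n ∸ i) j l (ℕₚ.≤-<-trans (ℕₚ.m∸n≤m n i) n<m)) a b))

  geom-extend : ∀ {n} N a b → n ≤ N → sumTo N (λ m → powS g m n a b) ≡ geom g n a b
  geom-extend {n} N a b n≤N = sumTo-extend N _ n≤N (λ m n<m → powS-vanish m n a b n<m)

  ⊗-geom : ∀ n a b → (g ⊗ geom g) n a b ≡ sumTo n (λ m → powS g (suc m) n a b)
  ⊗-geom n a b = begin
    sumTo n (λ i → (g i ✶ geom g (n ∸ i)) a b)
      ≡⟨ sumTo-cong n (λ i _ → ✶-congʳ (g i)
           (λ j l → sym (geom-extend n j l (ℕₚ.m∸n≤m n i))) a b) ⟩
    sumTo n (λ i → (g i ✶ (λ j l → sumTo n (λ m → powS g m (n ∸ i) j l))) a b)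
      ≡⟨ sumTo-cong n (λ i _ → ✶-sumToʳ (g i) n (λ m → powS g m (n ∸ i)) a b) ⟩
    sumTo n (λ i → sumTo n (λ m → (g i ✶ powS g m (n ∸ i)) a b))
      ≡⟨ sumTo-comm n n _ ⟩
    sumTo n (λ m → powS g (suc m) n a b) ∎
    where open ≡-Reasoning

  geom-unfold : ∀ n a b → geom g n a b ≡ oneS n a b + (g ⊗ geom g) n a b
  geom-unfold n a b = begin
    geom g n a b                                        ≡⟨ geom-extend (suc n) a b (ℕₚ.n≤1+n n) ⟨
    sumTo (suc n) (λ m → powS g m n a b)                ≡⟨ sumTo-suc n _ ⟩
    oneS n a b + sumTo n (λ m → powS g (suc m) n a b)   ≡⟨ cong (λ x → oneS n a b + x) (⊗-geom n a b) ⟨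
    oneS n a b + (g ⊗ geom g) n a b                     ∎
    where open ≡-Reasoning

-- Truncations of the continued fraction

cf-term : ℕ → Series → Series
cf-term i H = zS (K' i) ⊕ zS (qS H)

CF-zero : ∀ d s a b → CF d s 0 a b ≡ oneS 0 a b
CF-zero zero    s a b = refl
CF-zero (suc d) s a b = refl

cf-term-cong : ∀ s {H H'} i → (∀ a b → H i a b ≡ H' i a b) →
  ∀ a b → cf-term s H (suc i) a b ≡ cf-term s H' (suc i) a b
cf-term-cong s i H≗H' a zero    = refl
cf-term-cong s i H≗H' a (suc b) = cong (λ x → K' s i a (suc b) + x) (H≗H' a b)

module _ (G : ℕ → Series)
         (G-unfold : ∀ s n a b → G s n a b ≡ oneS n a b + (cf-term s (G (suc s)) ⊗ G s) n a b) where

  private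
    AgreesWithCF : ℕ → Set
    AgreesWithCF n = ∀ d s a b → n ≤ d → G s n a b ≡ CF d s n a b

    agree : ∀ n → (∀ {k} → k < n → AgreesWithCF k) → AgreesWithCF n
    agree zero _ d s a b _ = begin
      G s 0 a b                     ≡⟨ G-unfold s 0 a b ⟩
      oneS 0 a b + (f ⊗ G s) 0 a b  ≡⟨ cong (λ x → oneS 0 a b + x) (⊗-noConstantˡ-zero f (G s) (λ _ _ → refl) a b) ⟩
      oneS 0 a b + 0ℤ               ≡⟨ ℤₚ.+-identityʳ _ ⟩
      oneS 0 a b                    ≡⟨ CF-zero d s a b ⟨
      CF d s 0 a b                  ∎
      where
      open ≡-Reasoning
      f = cf-term s (G (suc s))
    agree (suc n) ih (suc d) s a b (s≤s n≤d) = begin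
      G s (suc n) a b                                      ≡⟨ G-unfold s (suc n) a b ⟩
      oneS (suc n) a b + (f ⊗ G s) (suc n) a b             ≡⟨ cong (λ x → oneS (suc n) a b + x) products-agree ⟩
      oneS (suc n) a b + (f' ⊗ CF (suc d) s) (suc n) a b   ≡⟨ geom-unfold f' (λ _ _ → refl) (suc n) a b ⟨
      CF (suc d) s (suc n) a b                             ∎
      where
      open ≡-Reasoning
      f  = cf-term s (G (suc s))
      f' = cf-term s (CF d (suc s))
      products-agree : (f ⊗ G s) (suc n) a b ≡ (f' ⊗ CF (suc d) s) (suc n) a b
      products-agree = ⊗-cong-suc f f' (G s) (CF (suc d) s) (λ _ _ → refl) (λ _ _ → refl) n
        (λ i i≤n → cf-term-cong s i (λ a b → ih (s≤s i≤n) d (suc s) a b (ℕₚ.≤-trans i≤n n≤d)))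
        (λ k k≤n a b → ih (s≤s k≤n) (suc d) s a b (ℕₚ.m≤n⇒m≤1+n (ℕₚ.≤-trans k≤n n≤d))) a b

  -- The coefficient of z^(n+1) on the right involves only coefficients of degree ≤ n.
  CF-agrees : ∀ n d s a b → n ≤ d → G s n a b ≡ CF d s n a b
  CF-agrees = <-rec AgreesWithCF agree

<ᵇ-true : ∀ {a b} → a < b → (a <ᵇ b) ≡ true
<ᵇ-true {a} {b} = dec-true (a ℕₚ.<? b)

<ᵇ-false : ∀ {a b} → b ≤ a → (a <ᵇ b) ≡ false
<ᵇ-false {a} {b} b≤a = dec-false (a ℕₚ.<? b) (ℕₚ.≤⇒≯ b≤a)

<ᵇ-false⁻ : ∀ {a b} → (a <ᵇ b) ≡ false → b ≤ a
<ᵇ-false⁻ eq = ℕₚ.≮⇒≥ (λ a<b → subst T eq (ℕₚ.<⇒<ᵇ a<b))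

≡ᵇ-refl : ∀ m → (m ≡ᵇ m) ≡ true
≡ᵇ-refl m = dec-true (m ℕₚ.≟ m) refl

≡ᵇ-false : ∀ {m n} → m ≢ n → (m ≡ᵇ n) ≡ false
≡ᵇ-false {m} {n} = dec-false (m ℕₚ.≟ n)

ShiftInvariant : (ℕ → ℕ → Bool) → Set
ShiftInvariant r = ∀ k i v → r (k ℕ.+ i) (k ℕ.+ v) ≡ r i v

≡ᵇ-shiftInvariant : ShiftInvariant (λ i v → v ≡ᵇ i)
≡ᵇ-shiftInvariant zero    i v = refl
≡ᵇ-shiftInvariant (suc k) i v = ≡ᵇ-shiftInvariant k i v

<ᵇ-shiftInvariant : ShiftInvariant _<ᵇ_
<ᵇ-shiftInvariant zero    i v = refl
<ᵇ-shiftInvariant (suc k) i v = <ᵇ-shiftInvariant k i v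

any-++ : ∀ {A : Set} (p : A → Bool) xs ys → any p (xs ++ ys) ≡ any p xs ∨ any p ys
any-++ p []       ys = refl
any-++ p (x ∷ xs) ys = trans (cong (p x ∨_) (any-++ p xs ys)) (sym (∨-assoc (p x) (any p xs) (any p ys)))

module _ {A B : Set} (f : A → List B) where

  ∈-concatMap-∃⁻ : ∀ xs {y} → y ∈ concatMap f xs → ∃ λ x → x ∈ xs × y ∈ f x
  ∈-concatMap-∃⁻ xs y∈ = find (∈-concatMap⁻ f {xs = xs} y∈)

  ∈-concatMap-∃⁺ : ∀ {xs x y} → x ∈ xs → y ∈ f x → y ∈ concatMap f xs
  ∈-concatMap-∃⁺ x∈ y∈ = ∈-concatMap⁺ f (lose x∈ y∈)

  concatMap-unique : ∀ {xs} → Unique xs → (∀ {x} → x ∈ xs → Unique (f x)) →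
    (∀ {x x' y} → x ∈ xs → x' ∈ xs → y ∈ f x → y ∈ f x' → x ≡ x') → Unique (concatMap f xs)
  concatMap-unique {[]}     []         _        _        = []
  concatMap-unique {x ∷ xs} (x∉ ∷ !xs) !f disjoint =
    Uniqueₚ.++⁺ (!f (here refl)) (concatMap-unique !xs (!f ∘ there) (λ p q → disjoint (there p) (there q)))
      λ (y∈fx , y∈rest) → let x' , x'∈ , y∈fx' = ∈-concatMap-∃⁻ xs y∈rest in
        All.lookup x∉ x'∈ (disjoint (here refl) (there x'∈) y∈fx y∈fx')

map-unique : ∀ {A B : Set} (f : A → B) {xs} → Unique xs →
  (∀ {x x'} → x ∈ xs → x' ∈ xs → f x ≡ f x' → x ≡ x') → Unique (map f xs)
map-unique f {[]}     []         _   = []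
map-unique f {x ∷ xs} (x∉ ∷ !xs) inj =
  All.tabulate (λ y∈ fx≡y → let x' , x'∈ , y≡fx' = ∈-map⁻ f y∈ in
    All.lookup x∉ x'∈ (inj (here refl) (there x'∈) (trans fx≡y y≡fx')))
  ∷ map-unique f !xs (λ p q → inj (there p) (there q))

++-∷-injective : ∀ {A : Set} {x : A} α α' {γ γ'} → x ∉ α → x ∉ α' →
  α ++ x ∷ γ ≡ α' ++ x ∷ γ' → α ≡ α' × γ ≡ γ'
++-∷-injective []      []        _   _    eq = refl , Listₚ.∷-injectiveʳ eq
++-∷-injective []      (_ ∷ _)   _   x∉α' eq = ⊥-elim (x∉α' (here (Listₚ.∷-injectiveˡ eq)))
++-∷-injective (_ ∷ _) []        x∉α _    eq = ⊥-elim (x∉α (here (sym (Listₚ.∷-injectiveˡ eq))))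
++-∷-injective (a ∷ α) (a' ∷ α') x∉α x∉α' eq with Listₚ.∷-injective eq
... | refl , eq' = Product.map₁ (cong (a ∷_)) (++-∷-injective α α' (x∉α ∘ there) (x∉α' ∘ there) eq')

Unique-++⇒≢ : ∀ {A : Set} (xs : List A) {ys x y} → Unique (xs ++ ys) → x ∈ xs → y ∈ ys → x ≢ y
Unique-++⇒≢ (_ ∷ xs) (x∉ ∷ _)  (here refl) y∈ = All.lookup x∉ (∈-++⁺ʳ xs y∈)
Unique-++⇒≢ (_ ∷ xs) (_ ∷ !xs) (there x∈)  y∈ = Unique-++⇒≢ xs !xs x∈ y∈

Unique-resp-↭ : ∀ {A : Set} {xs ys : List A} → xs ↭ ys → Unique xs → Unique ys
Unique-resp-↭ xs↭ys = ↭ₛₚ.Unique-resp-↭ (setoid _) (↭⇒↭ₛ xs↭ys)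

∈-++-∷⁺ : ∀ {A : Set} {x : A} u w {c} → c ∈ u ++ w → c ∈ u ++ x ∷ w
∈-++-∷⁺ u w c∈ with ∈-++⁻ u c∈
... | inj₁ c∈u = ∈-++⁺ˡ c∈u
... | inj₂ c∈w = ∈-++⁺ʳ u (there c∈w)

range : ℕ → List ℕ
range zero    = []
range (suc n) = suc n ∷ range n

∈-range⁻ : ∀ {n x} → x ∈ range n → 1 ≤ x × x ≤ n
∈-range⁻ {suc n} (here refl) = s≤s z≤n , ℕₚ.≤-refl
∈-range⁻ {suc n} (there x∈) = Product.map₂ ℕₚ.m≤n⇒m≤1+n (∈-range⁻ x∈)

length-range : ∀ n → length (range n) ≡ n
length-range zero    = refl
length-range (suc n) = cong suc (length-range n)

↭-range-length : ∀ {n π} → π ↭ range n → length π ≡ n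
↭-range-length {n} π↭ = trans (↭ₚ.↭-length π↭) (length-range n)

range-unique : ∀ n → Unique (range n)
range-unique zero    = []
range-unique (suc n) = All.tabulate (λ x∈ 1+n≡x → ℕₚ.<-irrefl (sym 1+n≡x) (s≤s (proj₂ (∈-range⁻ x∈))))
                     ∷ range-unique n

range-+ : ∀ k m → range (k ℕ.+ m) ≡ map (k ℕ.+_) (range m) ++ range k
range-+ k zero    = cong range (ℕₚ.+-identityʳ k)
range-+ k (suc m) rewrite ℕₚ.+-suc k m = cong (suc (k ℕ.+ m) ∷_) (range-+ k m)

∈-insertions⁺ : ∀ x τ₁ τ₂ → τ₁ ++ x ∷ τ₂ ∈ insertions x (τ₁ ++ τ₂)
∈-insertions⁺ x []       []       = here refl
∈-insertions⁺ x []       (_ ∷ _)  = here refl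
∈-insertions⁺ x (y ∷ τ₁) τ₂       = there (∈-map⁺ (y ∷_) (∈-insertions⁺ x τ₁ τ₂))

∈-insertions⁻ : ∀ x τ {π} → π ∈ insertions x τ → ∃₂ λ τ₁ τ₂ → τ ≡ τ₁ ++ τ₂ × π ≡ τ₁ ++ x ∷ τ₂
∈-insertions⁻ x []       (here refl) = [] , [] , refl , refl
∈-insertions⁻ x (y ∷ ys) (here refl) = [] , y ∷ ys , refl , refl
∈-insertions⁻ x (y ∷ ys) (there π∈) with map∷⁻ π∈
... | ρ , ρ∈ , refl with ∈-insertions⁻ x ys ρ∈
... | τ₁ , τ₂ , refl , refl = y ∷ τ₁ , τ₂ , refl , refl

insertions-unique : ∀ x τ → x ∉ τ → Unique (insertions x τ)
insertions-unique x []       _   = [] ∷ []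
insertions-unique x (y ∷ ys) x∉ =
  All.tabulate (λ π∈ eq → let ρ , _ , π≡ = map∷⁻ π∈ in x∉ (here (Listₚ.∷-injectiveˡ (trans eq π≡))))
  ∷ Uniqueₚ.map⁺ Listₚ.∷-injectiveʳ (insertions-unique x ys (x∉ ∘ there))

perms-↭ : ∀ n {π} → π ∈ perms n → π ↭ range n
perms-↭ zero    (here refl) = ↭-refl
perms-↭ (suc n) π∈ with ∈-concatMap-∃⁻ (insertions (suc n)) (perms n) π∈
... | τ , τ∈ , π∈ins with ∈-insertions⁻ (suc n) τ π∈ins
... | τ₁ , τ₂ , refl , refl = ↭-trans (↭ₚ.shift (suc n) τ₁ τ₂) (↭-prep (suc n) (perms-↭ n τ∈))

↭-range⇒∈-perms : ∀ n {π} → π ↭ range n → π ∈ perms n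
↭-range⇒∈-perms zero    π↭ rewrite ↭ₚ.↭-empty-inv π↭ = here refl
↭-range⇒∈-perms (suc n) π↭ with ∈-∃++ (↭ₚ.∈-resp-↭ (↭-sym π↭) (here refl))
... | τ₁ , τ₂ , refl = ∈-concatMap-∃⁺ (insertions (suc n))
  (↭-range⇒∈-perms n (↭ₚ.drop-mid τ₁ [] π↭)) (∈-insertions⁺ (suc n) τ₁ τ₂)

perms-unique : ∀ n → Unique (perms n)
perms-unique zero    = [] ∷ []
perms-unique (suc n) = concatMap-unique (insertions (suc n)) (perms-unique n)
  (λ τ∈ → insertions-unique (suc n) _ (max∉ τ∈)) disjoint
  where
  max∉ : ∀ {τ} → τ ∈ perms n → suc n ∉ τ
  max∉ τ∈ 1+n∈ = ℕₚ.<-irrefl refl (proj₂ (∈-range⁻ (↭ₚ.∈-resp-↭ (perms-↭ n τ∈) 1+n∈)))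
  disjoint : ∀ {τ τ' π} → τ ∈ perms n → τ' ∈ perms n →
    π ∈ insertions (suc n) τ → π ∈ insertions (suc n) τ' → τ ≡ τ'
  disjoint {τ} {τ'} τ∈ τ'∈ π∈ π∈'
    with ∈-insertions⁻ (suc n) τ π∈ | ∈-insertions⁻ (suc n) τ' π∈'
  ... | τ₁ , τ₂ , refl , refl | τ₁' , τ₂' , refl , π≡
    with ++-∷-injective τ₁ τ₁' (max∉ τ∈ ∘ ∈-++⁺ˡ) (max∉ τ'∈ ∘ ∈-++⁺ˡ) π≡
  ... | refl , refl = refl

↭-range-split : ∀ n π₁ π₂ → π₁ ++ π₂ ↭ range n → (∀ {a c} → a ∈ π₁ → c ∈ π₂ → a < c) →
  π₁ ↭ range (length π₁) × π₂ ↭ map (length π₁ ℕ.+_) (range (length π₂))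
↭-range-split zero    []      []      _  _ = ↭-refl , ↭-refl
↭-range-split zero    (_ ∷ _) _       π↭ _ = ⊥-elim (↭ₚ.¬x∷xs↭[] π↭)
↭-range-split zero    []      (_ ∷ _) π↭ _ = ⊥-elim (↭ₚ.¬x∷xs↭[] π↭)
↭-range-split (suc n) π₁ π₂ π↭ π₁<π₂ with ∈-++⁻ π₁ (↭ₚ.∈-resp-↭ (↭-sym π↭) (here refl))
↭-range-split (suc n) π₁ [] π↭ π₁<π₂ | inj₁ _ =
  subst (λ k → π₁ ↭ range k) (sym (↭-range-length π₁↭)) π₁↭ , ↭-refl
  where π₁↭ = subst (_↭ range (suc n)) (Listₚ.++-identityʳ π₁) π↭
↭-range-split (suc n) π₁ (c ∷ π₂) π↭ π₁<π₂ | inj₁ max∈π₁ =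
  ⊥-elim (ℕₚ.<⇒≱ (π₁<π₂ max∈π₁ (here refl)) (proj₂ (∈-range⁻ (↭ₚ.∈-resp-↭ π↭ (∈-++⁺ʳ π₁ (here refl))))))
↭-range-split (suc n) π₁ π₂ π↭ π₁<π₂ | inj₂ max∈π₂ with ∈-∃++ max∈π₂
... | u , w , refl = π₁↭ , π₂↭
  where
  rest↭ : π₁ ++ u ++ w ↭ range n
  rest↭ = subst (_↭ range n) (Listₚ.++-assoc π₁ u w) (↭ₚ.drop-mid (π₁ ++ u) []
            (subst (_↭ suc n ∷ range n) (sym (Listₚ.++-assoc π₁ u (suc n ∷ w))) π↭))
  ih = ↭-range-split n π₁ (u ++ w) rest↭ (λ a∈ c∈ → π₁<π₂ a∈ (∈-++-∷⁺ u w c∈))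
  π₁↭ = proj₁ ih
  k  = length π₁
  m' = length (u ++ w)
  1+n≡k+1+m' : suc n ≡ k ℕ.+ suc m'
  1+n≡k+1+m' = sym (trans (ℕₚ.+-suc k m')
    (cong suc (trans (sym (Listₚ.length-++ π₁)) (↭-range-length rest↭))))
  π₂↭ : u ++ suc n ∷ w ↭ map (k ℕ.+_) (range (length (u ++ suc n ∷ w)))
  π₂↭ rewrite Listₚ.length-++-sucʳ u (suc n) w =
    ↭-trans (↭ₚ.shift (suc n) u w)
      (subst (λ x → suc n ∷ u ++ w ↭ x ∷ map (k ℕ.+_) (range m')) 1+n≡k+1+m' (↭-prep (suc n) (proj₂ ih)))

-- 231-avoiding permutations

Avoids : List ℕ → Set
Avoids π = contains231 π ≡ false

∈-S231⁻ : ∀ n {π} → π ∈ S231 n → π ↭ range n × Avoids π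
∈-S231⁻ n {π} π∈ with ∈-filter⁻ (T? ∘ avoids231) {xs = perms n} π∈
... | π∈perms , avoids with contains231 π
...   | false = perms-↭ n π∈perms , refl

∈-S231⁺ : ∀ n {π} → π ↭ range n → Avoids π → π ∈ S231 n
∈-S231⁺ n {π} π↭ avoids = ∈-filter⁺ (T? ∘ avoids231) (↭-range⇒∈-perms n π↭) avoids-T
  where
  avoids-T : T (avoids231 π)
  avoids-T rewrite avoids = _

∈-S231-entry : ∀ {n π x} → π ∈ S231 n → x ∈ π → 1 ≤ x × x ≤ n
∈-S231-entry {n} π∈ x∈ = ∈-range⁻ (↭ₚ.∈-resp-↭ (proj₁ (∈-S231⁻ n π∈)) x∈)

∈-S231⇒length : ∀ {n π} → π ∈ S231 n → length π ≡ n
∈-S231⇒length {n} π∈ = ↭-range-length (proj₁ (∈-S231⁻ n π∈))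

∉-S231 : ∀ {k M α} → k < M → α ∈ S231 k → M ∉ α
∉-S231 k<M α∈ M∈ = ℕₚ.<⇒≱ k<M (proj₂ (∈-S231-entry α∈ M∈))

S231-unique : ∀ n → Unique (S231 n)
S231-unique n = Uniqueₚ.filter⁺ (T? ∘ avoids231) (perms-unique n)

contains231-shift : ∀ k β → contains231 (map (k ℕ.+_) β) ≡ contains231 β
contains231-shift k []      = refl
contains231-shift k (a ∷ β) = cong₂ _∨_ (has31after-shift β) (contains231-shift k β)
  where
  below-shift : ∀ bs → any (_<ᵇ k ℕ.+ a) (map (k ℕ.+_) bs) ≡ any (_<ᵇ a) bs
  below-shift []       = refl
  below-shift (b ∷ bs) = cong₂ _∨_ (<ᵇ-shiftInvariant k b a) (below-shift bs)
  has31after-shift : ∀ bs → has31after (k ℕ.+ a) (map (k ℕ.+_) bs) ≡ has31after a bs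
  has31after-shift []       = refl
  has31after-shift (b ∷ bs) =
    cong₂ _∨_ (cong₂ _∧_ (<ᵇ-shiftInvariant k a b) (below-shift bs)) (has31after-shift bs)

any-<ᵇ-above : ∀ a ys → All (a ≤_) ys → any (_<ᵇ a) ys ≡ false
any-<ᵇ-above a []       []           = refl
any-<ᵇ-above a (y ∷ ys) (a≤y ∷ a≤ys) = cong₂ _∨_ (<ᵇ-false a≤y) (any-<ᵇ-above a ys a≤ys)

any-<ᵇ-above⁻ : ∀ a ys → any (_<ᵇ a) ys ≡ false → All (a ≤_) ys
any-<ᵇ-above⁻ a []       _  = []
any-<ᵇ-above⁻ a (y ∷ ys) eq =
  <ᵇ-false⁻ (∨-conicalˡ _ _ eq) ∷ any-<ᵇ-above⁻ a ys (∨-conicalʳ _ _ eq)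

has31after-above : ∀ a ys → All (a ≤_) ys → has31after a ys ≡ false
has31after-above a []       []           = refl
has31after-above a (y ∷ ys) (_ ∷ a≤ys)
  rewrite any-<ᵇ-above a ys a≤ys | ∧-zeroʳ (a <ᵇ y) = has31after-above a ys a≤ys

has31after-below : ∀ a ys → All (_< a) ys → has31after a ys ≡ false
has31after-below a []       []            = refl
has31after-below a (y ∷ ys) (y<a ∷ ys<a)
  rewrite <ᵇ-false (ℕₚ.<⇒≤ y<a) = has31after-below a ys ys<a

has31after-++-above : ∀ a xs ys → All (a ≤_) ys → has31after a (xs ++ ys) ≡ has31after a xs
has31after-++-above a []       ys a≤ys = has31after-above a ys a≤ys
has31after-++-above a (x ∷ xs) ys a≤ys
  rewrite any-++ (_<ᵇ a) xs ys | any-<ᵇ-above a ys a≤ys | ∨-identityʳ (any (_<ᵇ a) xs)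
        | has31after-++-above a xs ys a≤ys = refl

contains231-around-max : ∀ M α γ → All (_< M) α → All (_< M) γ → (∀ {a} → a ∈ α → All (a <_) γ) →
  contains231 (α ++ M ∷ γ) ≡ contains231 α ∨ contains231 γ
contains231-around-max M []      γ _           γ<M _   rewrite has31after-below M γ γ<M = refl
contains231-around-max M (a ∷ α) γ (a<M ∷ α<M) γ<M α<γ
  rewrite has31after-++-above a α (M ∷ γ) (ℕₚ.<⇒≤ a<M ∷ All.map ℕₚ.<⇒≤ (α<γ (here refl)))
        | contains231-around-max M α γ α<M γ<M (α<γ ∘ there) =
  sym (∨-assoc (has31after a α) (contains231 α) (contains231 γ))

has31after-∷-above : ∀ a xs b ys → has31after a (xs ++ b ∷ ys) ≡ false → a < b → All (a ≤_) ys
has31after-∷-above a []       b ys no231 a<b = any-<ᵇ-above⁻ a ys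
  (subst (λ t → t ∧ any (_<ᵇ a) ys ≡ false) (<ᵇ-true a<b) (∨-conicalˡ _ _ no231))
has31after-∷-above a (x ∷ xs) b ys no231 a<b = has31after-∷-above a xs b ys (∨-conicalʳ _ _ no231) a<b

avoids-around-max⇒≤ : ∀ M α γ → Avoids (α ++ M ∷ γ) → All (_< M) α → ∀ {a} → a ∈ α → All (a ≤_) γ
avoids-around-max⇒≤ M (a ∷ α) γ avoids (a<M ∷ _) (here refl) =
  has31after-∷-above a α M γ (∨-conicalˡ _ _ avoids) a<M
avoids-around-max⇒≤ M (_ ∷ α) γ avoids (_ ∷ α<M) (there a∈) =
  avoids-around-max⇒≤ M α γ (∨-conicalʳ _ _ avoids) α<M a∈

around : ℕ → List ℕ → List ℕ → List ℕ
around M α β = α ++ M ∷ map (length α ℕ.+_) β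

around-injective : ∀ {M α α' β β'} → M ∉ α → M ∉ α' → around M α β ≡ around M α' β' → α ≡ α' × β ≡ β'
around-injective {α = α} {α'} M∉α M∉α' eq with ++-∷-injective α α' M∉α M∉α' eq
... | refl , shifted≡ = refl , Listₚ.map-injective (ℕₚ.+-cancelˡ-≡ (length α) _ _) shifted≡

insert-max-∈-S231 : ∀ k m {α β} → α ∈ S231 k → β ∈ S231 m →
  α ++ suc (k ℕ.+ m) ∷ map (k ℕ.+_) β ∈ S231 (suc (k ℕ.+ m))
insert-max-∈-S231 k m {α} {β} α∈ β∈ = ∈-S231⁺ (suc (k ℕ.+ m)) π↭ π-avoids
  where
  M = suc (k ℕ.+ m)
  γ = map (k ℕ.+_) β
  α↭ = proj₁ (∈-S231⁻ k α∈)
  β↭ = proj₁ (∈-S231⁻ m β∈)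
  π↭ : α ++ M ∷ γ ↭ range M
  π↭ = ↭-trans (↭ₚ.shift M α γ) (↭-prep M (↭-trans (↭ₚ.++⁺ α↭ (↭ₚ.map⁺ (k ℕ.+_) β↭))
         (subst (range k ++ map (k ℕ.+_) (range m) ↭_) (sym (range-+ k m))
           (↭ₚ.++-comm (range k) (map (k ℕ.+_) (range m))))))
  α-bounds : ∀ {a} → a ∈ α → 1 ≤ a × a ≤ k
  α-bounds a∈ = ∈-range⁻ (↭ₚ.∈-resp-↭ α↭ a∈)
  γ-bounds : ∀ {c} → c ∈ γ → ∃ λ y → c ≡ k ℕ.+ y × 1 ≤ y × y ≤ m
  γ-bounds c∈ = let y , y∈ , c≡ = ∈-map⁻ (k ℕ.+_) c∈ in y , c≡ , ∈-range⁻ (↭ₚ.∈-resp-↭ β↭ y∈)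
  α<M : All (_< M) α
  α<M = All.tabulate (λ a∈ → s≤s (ℕₚ.≤-trans (proj₂ (α-bounds a∈)) (ℕₚ.m≤m+n k m)))
  γ<M : All (_< M) γ
  γ<M = All.tabulate (λ c∈ → let y , c≡ , _ , y≤m = γ-bounds c∈ in
          subst (_< M) (sym c≡) (s≤s (ℕₚ.+-monoʳ-≤ k y≤m)))
  α<γ : ∀ {a} → a ∈ α → All (a <_) γ
  α<γ a∈ = All.tabulate (λ c∈ → let y , c≡ , 1≤y , _ = γ-bounds c∈ in
             subst (_ <_) (sym c≡) (ℕₚ.≤-trans (s≤s (proj₂ (α-bounds a∈)))
               (subst (_≤ k ℕ.+ y) (ℕₚ.+-comm k 1) (ℕₚ.+-monoʳ-≤ k 1≤y))))
  π-avoids : Avoids (α ++ M ∷ γ)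
  π-avoids = trans (contains231-around-max M α γ α<M γ<M α<γ)
    (cong₂ _∨_ (proj₂ (∈-S231⁻ k α∈)) (trans (contains231-shift k β) (proj₂ (∈-S231⁻ m β∈))))

around-∈-S231 : ∀ {n m α β} → m ≤ n → α ∈ S231 (n ∸ m) → β ∈ S231 m → around (suc n) α β ∈ S231 (suc n)
around-∈-S231 {n} {m} {α} {β} m≤n α∈ β∈ =
  subst₂ (λ k N → α ++ suc N ∷ map (k ℕ.+_) β ∈ S231 (suc N))
    (sym (∈-S231⇒length α∈)) (ℕₚ.m∸n+n≡m m≤n)
    (insert-max-∈-S231 (n ∸ m) m α∈ β∈)

around-max-split : ∀ n α γ → α ++ suc n ∷ γ ↭ range (suc n) → Avoids (α ++ suc n ∷ γ) →
  (∀ {a c} → a ∈ α → c ∈ γ → a < c) × Avoids α × Avoids γ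
around-max-split n α γ π↭ π-avoids = α<γ , ∨-conicalˡ _ _ parts-avoid , ∨-conicalʳ _ _ parts-avoid
  where
  rest↭ : α ++ γ ↭ range n
  rest↭ = ↭ₚ.drop-mid α [] π↭
  below-max : ∀ {x} → x ∈ α ++ γ → x < suc n
  below-max x∈ = s≤s (proj₂ (∈-range⁻ (↭ₚ.∈-resp-↭ rest↭ x∈)))
  α<M : All (_< suc n) α
  α<M = All.tabulate (below-max ∘ ∈-++⁺ˡ)
  γ<M : All (_< suc n) γ
  γ<M = All.tabulate (below-max ∘ ∈-++⁺ʳ α)
  α<γ : ∀ {a c} → a ∈ α → c ∈ γ → a < c
  α<γ a∈ c∈ = ℕₚ.≤∧≢⇒< (All.lookup (avoids-around-max⇒≤ (suc n) α γ π-avoids α<M a∈) c∈)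
    (Unique-++⇒≢ α (Unique-resp-↭ (↭-sym rest↭) (range-unique n)) a∈ c∈)
  parts-avoid : contains231 α ∨ contains231 γ ≡ false
  parts-avoid = trans (sym (contains231-around-max (suc n) α γ α<M γ<M (λ a∈ → All.tabulate (α<γ a∈))))
                  π-avoids

S231-suc-decompose : ∀ n {π} → π ∈ S231 (suc n) →
  ∃ λ m → m ≤ n × ∃₂ λ α β → α ∈ S231 (n ∸ m) × β ∈ S231 m × π ≡ around (suc n) α β
S231-suc-decompose n {π} π∈ with ∈-S231⁻ (suc n) π∈
... | π↭ , π-avoids with ∈-∃++ (↭ₚ.∈-resp-↭ (↭-sym π↭) (here refl))
... | α , γ , refl with around-max-split n α γ π↭ π-avoids
... | α<γ , α-avoids , γ-avoids with ↭-range-split n α γ (↭ₚ.drop-mid α [] π↭) α<γ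
... | α↭ , γ↭ with ↭ₚ.↭-map-inv (length α ℕ.+_) (↭-sym γ↭)
... | β , refl , β↭ = length β , m≤n , α , β , α∈ , β∈ , refl
  where
  k+m≡n : length α ℕ.+ length β ≡ n
  k+m≡n = trans (cong (length α ℕ.+_) (sym (Listₚ.length-map (length α ℕ.+_) β)))
            (trans (sym (Listₚ.length-++ α)) (↭-range-length (↭ₚ.drop-mid α [] π↭)))
  m≤n : length β ≤ n
  m≤n = subst (length β ≤_) k+m≡n (ℕₚ.m≤n+m (length β) (length α))
  α∈ : α ∈ S231 (n ∸ length β)
  α∈ = ∈-S231⁺ _ (subst (λ k → α ↭ range k)
         (trans (sym (ℕₚ.m+n∸n≡m _ (length β))) (cong (_∸ length β) k+m≡n)) α↭)
         α-avoids
  β∈ : β ∈ S231 (length β)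
  β∈ = ∈-S231⁺ _ (↭-sym (subst (λ m → range m ↭ β) (Listₚ.length-map _ β) β↭))
         (trans (sym (contains231-shift (length α) β)) γ-avoids)

blocks : ℕ → ℕ → List (List ℕ)
blocks n m = concatMap (λ β → map (λ α → around (suc n) α β) (S231 (n ∸ m))) (S231 m)

decomposition : ℕ → List (List ℕ)
decomposition n = concatMap (blocks n) (upTo (suc n))

∈-blocks⁻ : ∀ n m {π} → π ∈ blocks n m →
  ∃₂ λ α β → α ∈ S231 (n ∸ m) × β ∈ S231 m × π ≡ around (suc n) α β
∈-blocks⁻ n m π∈ with ∈-concatMap-∃⁻ _ (S231 m) π∈
... | β , β∈ , π∈' with ∈-map⁻ _ π∈'
... | α , α∈ , π≡ = α , β , α∈ , β∈ , π≡

∈-blocks⁺ : ∀ n m {α β} → α ∈ S231 (n ∸ m) → β ∈ S231 m → around (suc n) α β ∈ blocks n m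
∈-blocks⁺ n m α∈ β∈ = ∈-concatMap-∃⁺ _ β∈ (∈-map⁺ _ α∈)

blocks-unique : ∀ n m → Unique (blocks n m)
blocks-unique n m = concatMap-unique _ (S231-unique m)
  (λ _ → map-unique _ (S231-unique (n ∸ m)) (λ α∈ α'∈ → proj₁ ∘ around-injective (max∉ α∈) (max∉ α'∈)))
  disjoint
  where
  max∉ : ∀ {α} → α ∈ S231 (n ∸ m) → suc n ∉ α
  max∉ = ∉-S231 (s≤s (ℕₚ.m∸n≤m n m))
  disjoint : ∀ {β β' π} → β ∈ S231 m → β' ∈ S231 m →
    π ∈ map (λ α → around (suc n) α β) (S231 (n ∸ m)) → π ∈ map (λ α → around (suc n) α β') (S231 (n ∸ m)) →
    β ≡ β'
  disjoint _ _ π∈ π∈' with ∈-map⁻ _ π∈ | ∈-map⁻ _ π∈'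
  ... | α , α∈ , refl | α' , α'∈ , π≡ = proj₂ (around-injective (max∉ α∈) (max∉ α'∈) π≡)

decomposition-unique : ∀ n → Unique (decomposition n)
decomposition-unique n =
  concatMap-unique (blocks n) (Uniqueₚ.upTo⁺ (suc n)) (λ {m} _ → blocks-unique n m) disjoint
  where
  disjoint : ∀ {m m' π} → m ∈ upTo (suc n) → m' ∈ upTo (suc n) → π ∈ blocks n m → π ∈ blocks n m' → m ≡ m'
  disjoint {m} {m'} m∈ m'∈ π∈ π∈' with ∈-blocks⁻ n m π∈ | ∈-blocks⁻ n m' π∈'
  ... | α , β , α∈ , β∈ , refl | α' , β' , α'∈ , β'∈ , π≡
    with around-injective (∉-S231 (s≤s (ℕₚ.m∸n≤m n m)) α∈) (∉-S231 (s≤s (ℕₚ.m∸n≤m n m')) α'∈) π≡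
  ... | refl , refl = trans (sym (∈-S231⇒length β∈)) (∈-S231⇒length β'∈)

S231-suc-↭ : ∀ n → S231 (suc n) ↭ decomposition n
S231-suc-↭ n = ∼bag⇒↭ (unique∧set⇒bag (S231-unique (suc n)) (decomposition-unique n) (mk⇔ to from))
  where
  to : ∀ {π} → π ∈ S231 (suc n) → π ∈ decomposition n
  to π∈ with S231-suc-decompose n π∈
  ... | m , m≤n , α , β , α∈ , β∈ , refl = ∈-concatMap-∃⁺ (blocks n) (∈-upTo⁺ (s≤s m≤n)) (∈-blocks⁺ n m α∈ β∈)
  from : ∀ {π} → π ∈ decomposition n → π ∈ S231 (suc n)
  from π∈ with ∈-concatMap-∃⁻ (blocks n) (upTo (suc n)) π∈
  ... | m , m∈ , π∈' with ∈-blocks⁻ n m π∈'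
  ... | α , β , α∈ , β∈ , refl = around-∈-S231 (ℕₚ.≤-pred (∈-upTo⁻ m∈)) α∈ β∈

countᵇ : ∀ {A : Set} → (A → Bool) → List A → ℕ
countᵇ p xs = length (filterᵇ p xs)

𝟙 : Bool → ℤ
𝟙 b = + (if b then 1 else 0)

module _ {A : Set} (p : A → Bool) where

  countᵇ-∷ : ∀ x xs → countᵇ p (x ∷ xs) ≡ (if p x then 1 else 0) ℕ.+ countᵇ p xs
  countᵇ-∷ x xs with p x
  ... | true  = refl
  ... | false = refl

  countᵇ-++ : ∀ xs ys → countᵇ p (xs ++ ys) ≡ countᵇ p xs ℕ.+ countᵇ p ys
  countᵇ-++ xs ys = trans (cong length (Listₚ.filter-++ (T? ∘ p) xs ys)) (Listₚ.length-++ (filterᵇ p xs))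

  countᵇ-↭ : ∀ {xs ys} → xs ↭ ys → countᵇ p xs ≡ countᵇ p ys
  countᵇ-↭ xs↭ys = ↭ₚ.↭-length (↭ₚ.filter-↭ (T? ∘ p) xs↭ys)

countᵇ-cong : ∀ {A : Set} {p q : A → Bool} xs → (∀ {x} → x ∈ xs → p x ≡ q x) → countᵇ p xs ≡ countᵇ q xs
countᵇ-cong             []       _   = refl
countᵇ-cong {p = p} {q} (x ∷ xs) p≗q =
  trans (countᵇ-∷ p x xs) (trans (cong₂ (λ b n → (if b then 1 else 0) ℕ.+ n) (p≗q (here refl))
    (countᵇ-cong xs (p≗q ∘ there))) (sym (countᵇ-∷ q x xs)))

countᵇ-const : ∀ {A : Set} b (xs : List A) → countᵇ (λ _ → b) xs ≡ (if b then length xs else 0)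
countᵇ-const true  []       = refl
countᵇ-const false []       = refl
countᵇ-const true  (x ∷ xs) = cong suc (countᵇ-const true xs)
countᵇ-const false (x ∷ xs) = countᵇ-const false xs

statGF : ∀ {A : Set} → (A → ℕ) → (A → ℕ) → List A → ℕ → ℕ → ℤ
statGF u v xs a b = + countᵇ (λ x → (u x ≡ᵇ a) ∧ (v x ≡ᵇ b)) xs

monomial : ℕ → ℕ → ℕ → ℕ → ℤ
monomial x y a b = 𝟙 ((x ≡ᵇ a) ∧ (y ≡ᵇ b))

module _ {A : Set} (u v : A → ℕ) where

  statGF-++ : ∀ xs ys a b → statGF u v (xs ++ ys) a b ≡ statGF u v xs a b + statGF u v ys a b
  statGF-++ xs ys a b = trans (cong +_ (countᵇ-++ p xs ys)) (ℤₚ.pos-+ (countᵇ p xs) (countᵇ p ys))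
    where p = λ x → (u x ≡ᵇ a) ∧ (v x ≡ᵇ b)

  statGF-singleton : ∀ x a b → statGF u v [ x ] a b ≡ monomial (u x) (v x) a b
  statGF-singleton x a b = cong +_ (trans (countᵇ-∷ (λ z → (u z ≡ᵇ a) ∧ (v z ≡ᵇ b)) x []) (ℕₚ.+-identityʳ _))

  statGF-↭ : ∀ {xs ys} → xs ↭ ys → ∀ a b → statGF u v xs a b ≡ statGF u v ys a b
  statGF-↭ xs↭ys a b = cong +_ (countᵇ-↭ (λ z → (u z ≡ᵇ a) ∧ (v z ≡ᵇ b)) xs↭ys)

  statGF-const : ∀ {x y} xs → (∀ {z} → z ∈ xs → u z ≡ x) → (∀ {z} → z ∈ xs → v z ≡ y) →
    ∀ a b → statGF u v xs a b ≡ monomial x y a b * + length xs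
  statGF-const {x} {y} xs u≡x v≡y a b =
    trans (cong +_ (trans (countᵇ-cong xs (λ z∈ → cong₂ (λ s t → (s ≡ᵇ a) ∧ (t ≡ᵇ b)) (u≡x z∈) (v≡y z∈)))
                          (countᵇ-const _ xs)))
          (𝟙-* ((x ≡ᵇ a) ∧ (y ≡ᵇ b)))
    where
    𝟙-* : ∀ c → + (if c then length xs else 0) ≡ 𝟙 c * + length xs
    𝟙-* true  = sym (ℤₚ.*-identityˡ _)
    𝟙-* false = refl

𝟙-∧ : ∀ p q → 𝟙 (p ∧ q) ≡ 𝟙 p * 𝟙 q
𝟙-∧ true  q = sym (ℤₚ.*-identityˡ (𝟙 q))
𝟙-∧ false q = refl

𝟙-≡ᵇ-convolution : ∀ x x' a → sumTo a (λ j → 𝟙 (x ≡ᵇ j) * 𝟙 (x' ≡ᵇ a ∸ j)) ≡ 𝟙 (x ℕ.+ x' ≡ᵇ a)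
𝟙-≡ᵇ-convolution zero    x' zero    = ℤₚ.*-identityˡ _
𝟙-≡ᵇ-convolution (suc x) x' zero    = refl
𝟙-≡ᵇ-convolution x       x' (suc a) =
  trans (sumTo-suc a (λ j → 𝟙 (x ≡ᵇ j) * 𝟙 (x' ≡ᵇ suc a ∸ j))) (split x)
  where
  split : ∀ x → 𝟙 (x ≡ᵇ 0) * 𝟙 (x' ≡ᵇ suc a) + sumTo a (λ j → 𝟙 (x ≡ᵇ suc j) * 𝟙 (x' ≡ᵇ a ∸ j))
              ≡ 𝟙 (x ℕ.+ x' ≡ᵇ suc a)
  split zero    =
    trans (cong₂ _+_ (ℤₚ.*-identityˡ (𝟙 (x' ≡ᵇ suc a))) (sumTo-≡0 a (λ _ _ → refl))) (ℤₚ.+-identityʳ _)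
  split (suc x) = trans (ℤₚ.+-identityˡ _) (𝟙-≡ᵇ-convolution x x' a)

monomial-✶ : ∀ x y x' y' a b → (monomial x y ✶ monomial x' y') a b ≡ monomial (x ℕ.+ x') (y ℕ.+ y') a b
monomial-✶ x y x' y' a b = begin
  (sumTo a λ j → sumTo b λ l → 𝟙 ((x ≡ᵇ j) ∧ (y ≡ᵇ l)) * 𝟙 ((x' ≡ᵇ a ∸ j) ∧ (y' ≡ᵇ b ∸ l)))
    ≡⟨ sumTo-cong a (λ j _ → sumTo-cong b (λ l _ → separate j l)) ⟩
  (sumTo a λ j → sumTo b λ l → (𝟙 (x ≡ᵇ j) * 𝟙 (x' ≡ᵇ a ∸ j)) * (𝟙 (y ≡ᵇ l) * 𝟙 (y' ≡ᵇ b ∸ l)))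
    ≡⟨ sumTo-*-sumTo a b _ _ ⟨
  sumTo a (λ j → 𝟙 (x ≡ᵇ j) * 𝟙 (x' ≡ᵇ a ∸ j)) * sumTo b (λ l → 𝟙 (y ≡ᵇ l) * 𝟙 (y' ≡ᵇ b ∸ l))
    ≡⟨ cong₂ _*_ (𝟙-≡ᵇ-convolution x x' a) (𝟙-≡ᵇ-convolution y y' b) ⟩
  𝟙 (x ℕ.+ x' ≡ᵇ a) * 𝟙 (y ℕ.+ y' ≡ᵇ b)
    ≡⟨ 𝟙-∧ (x ℕ.+ x' ≡ᵇ a) (y ℕ.+ y' ≡ᵇ b) ⟨
  monomial (x ℕ.+ x') (y ℕ.+ y') a b ∎
  where
  open ≡-Reasoning
  separate : ∀ j l → 𝟙 ((x ≡ᵇ j) ∧ (y ≡ᵇ l)) * 𝟙 ((x' ≡ᵇ a ∸ j) ∧ (y' ≡ᵇ b ∸ l))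
                   ≡ (𝟙 (x ≡ᵇ j) * 𝟙 (x' ≡ᵇ a ∸ j)) * (𝟙 (y ≡ᵇ l) * 𝟙 (y' ≡ᵇ b ∸ l))
  separate j l = trans (cong₂ _*_ (𝟙-∧ (x ≡ᵇ j) (y ≡ᵇ l)) (𝟙-∧ (x' ≡ᵇ a ∸ j) (y' ≡ᵇ b ∸ l)))
                       (*-interchange (𝟙 (x ≡ᵇ j)) (𝟙 (y ≡ᵇ l)) (𝟙 (x' ≡ᵇ a ∸ j)) (𝟙 (y' ≡ᵇ b ∸ l)))

module _ {A B C : Set} (u v : C → ℕ) (u₁ v₁ : B → ℕ) (u₂ v₂ : A → ℕ) (c : B → A → C) where

  private
    Additive : List B → List A → Set
    Additive βs αs = ∀ {β α} → β ∈ βs → α ∈ αs → u (c β α) ≡ u₁ β ℕ.+ u₂ α × v (c β α) ≡ v₁ β ℕ.+ v₂ α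

  statGF-map : ∀ β αs → Additive [ β ] αs →
    ∀ a b → statGF u v (map (c β) αs) a b ≡ (statGF u₁ v₁ [ β ] ✶ statGF u₂ v₂ αs) a b
  statGF-map β []       _   a b = sym (✶-zeroʳ (statGF u₁ v₁ [ β ]) (λ _ _ → refl) a b)
  statGF-map β (α ∷ αs) add a b = begin
    statGF u v ([ c β α ] ++ map (c β) αs) a b
      ≡⟨ statGF-++ u v [ c β α ] (map (c β) αs) a b ⟩
    statGF u v [ c β α ] a b + statGF u v (map (c β) αs) a b
      ≡⟨ cong₂ _+_ (trans (statGF-singleton u v (c β α) a b) (cong₂ (λ x y → monomial x y a b) u-additive v-additive))
                   (statGF-map β αs (λ β∈ α∈ → add β∈ (there α∈)) a b) ⟩
    monomial (u₁ β ℕ.+ u₂ α) (v₁ β ℕ.+ v₂ α) a b + rest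
      ≡⟨ cong (_+ rest) (monomial-✶ (u₁ β) (v₁ β) (u₂ α) (v₂ α) a b) ⟨
    (monomial (u₁ β) (v₁ β) ✶ monomial (u₂ α) (v₂ α)) a b + rest
      ≡⟨ cong (_+ rest) (✶-cong (λ j l → sym (statGF-singleton u₁ v₁ β j l))
                               (λ j l → sym (statGF-singleton u₂ v₂ α j l)) a b) ⟩
    (statGF u₁ v₁ [ β ] ✶ statGF u₂ v₂ [ α ]) a b + rest
      ≡⟨ ✶-distribˡ-+ (statGF u₁ v₁ [ β ]) (statGF u₂ v₂ [ α ]) (statGF u₂ v₂ αs) a b ⟨
    (statGF u₁ v₁ [ β ] ✶ (λ j l → statGF u₂ v₂ [ α ] j l + statGF u₂ v₂ αs j l)) a b
      ≡⟨ ✶-congʳ (statGF u₁ v₁ [ β ]) (λ j l → sym (statGF-++ u₂ v₂ [ α ] αs j l)) a b ⟩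
    (statGF u₁ v₁ [ β ] ✶ statGF u₂ v₂ (α ∷ αs)) a b ∎
    where
    open ≡-Reasoning
    rest = (statGF u₁ v₁ [ β ] ✶ statGF u₂ v₂ αs) a b
    u-additive = proj₁ (add (here refl) (here refl))
    v-additive = proj₂ (add (here refl) (here refl))

  statGF-product : ∀ βs αs → Additive βs αs →
    ∀ a b → statGF u v (concatMap (λ β → map (c β) αs) βs) a b ≡ (statGF u₁ v₁ βs ✶ statGF u₂ v₂ αs) a b
  statGF-product []       αs _   a b = sym (✶-zeroˡ (statGF u₂ v₂ αs) (λ _ _ → refl) a b)
  statGF-product (β ∷ βs) αs add a b = begin
    statGF u v (map (c β) αs ++ concatMap (λ β → map (c β) αs) βs) a b
      ≡⟨ statGF-++ u v (map (c β) αs) _ a b ⟩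
    statGF u v (map (c β) αs) a b + statGF u v (concatMap (λ β → map (c β) αs) βs) a b
      ≡⟨ cong₂ _+_ (statGF-map β αs (λ { (here refl) → add (here refl) }) a b)
                   (statGF-product βs αs (add ∘ there) a b) ⟩
    (statGF u₁ v₁ [ β ] ✶ statGF u₂ v₂ αs) a b + (statGF u₁ v₁ βs ✶ statGF u₂ v₂ αs) a b
      ≡⟨ ✶-distribʳ-+ (statGF u₁ v₁ [ β ]) (statGF u₁ v₁ βs) (statGF u₂ v₂ αs) a b ⟨
    ((λ j l → statGF u₁ v₁ [ β ] j l + statGF u₁ v₁ βs j l) ✶ statGF u₂ v₂ αs) a b
      ≡⟨ ✶-congˡ (statGF u₂ v₂ αs) (λ j l → sym (statGF-++ u₁ v₁ [ β ] βs j l)) a b ⟩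
    (statGF u₁ v₁ (β ∷ βs) ✶ statGF u₂ v₂ αs) a b ∎
    where open ≡-Reasoning

module _ {A : Set} (u v : A → ℕ) where

  statGF-concatMap-applyUpTo : ∀ (F : ℕ → List A) f n a b →
    statGF u v (concatMap F (applyUpTo f (suc n))) a b ≡ sumTo n (λ m → statGF u v (F (f m)) a b)
  statGF-concatMap-applyUpTo F f zero    a b =
    trans (statGF-++ u v (F (f 0)) [] a b) (ℤₚ.+-identityʳ _)
  statGF-concatMap-applyUpTo F f (suc n) a b =
    trans (statGF-++ u v (F (f 0)) _ a b)
      (trans (cong (λ x → statGF u v (F (f 0)) a b + x) (statGF-concatMap-applyUpTo F (f ∘ suc) n a b))
             (sym (sumTo-suc n (λ m → statGF u v (F (f m)) a b))))

statGF-S231-suc : ∀ (u v : List ℕ → ℕ) n a b →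
  statGF u v (S231 (suc n)) a b ≡ sumTo n (λ m → statGF u v (blocks n m) a b)
statGF-S231-suc u v n a b =
  trans (statGF-↭ u v (S231-suc-↭ n) a b) (statGF-concatMap-applyUpTo u v (blocks n) (λ m → m) n a b)

-- Catalan numbers

length-as-statGF : ∀ {A : Set} (xs : List A) → + length xs ≡ statGF (λ _ → 0) (λ _ → 0) xs 0 0
length-as-statGF xs =
  sym (trans (statGF-const (λ _ → 0) (λ _ → 0) {0} {0} xs (λ _ → refl) (λ _ → refl) 0 0) (ℤₚ.*-identityˡ _))

length-S231-suc : ∀ n → + length (S231 (suc n)) ≡ sumTo n (λ m → + length (S231 m) * + length (S231 (n ∸ m)))
length-S231-suc n = begin
  + length (S231 (suc n))
    ≡⟨ length-as-statGF (S231 (suc n)) ⟩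
  statGF o o (S231 (suc n)) 0 0
    ≡⟨ statGF-S231-suc o o n 0 0 ⟩
  sumTo n (λ m → statGF o o (blocks n m) 0 0)
    ≡⟨ sumTo-cong n (λ m _ → statGF-product o o o o o o (λ β α → around (suc n) α β) (S231 m) (S231 (n ∸ m))
                               (λ _ _ → refl , refl) 0 0) ⟩
  sumTo n (λ m → statGF o o (S231 m) 0 0 * statGF o o (S231 (n ∸ m)) 0 0)
    ≡⟨ sumTo-cong n (λ m _ → sym (cong₂ _*_ (length-as-statGF (S231 m)) (length-as-statGF (S231 (n ∸ m))))) ⟩
  sumTo n (λ m → + length (S231 m) * + length (S231 (n ∸ m))) ∎
  where
  open ≡-Reasoning
  o : List ℕ → ℕ
  o _ = 0

[k+1]*[n+1]C[k+1]≡[n+1]*nCk : ∀ n k → suc k ℕ.* (suc n C suc k) ≡ suc n ℕ.* (n C k)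
[k+1]*[n+1]C[k+1]≡[n+1]*nCk zero    zero    = refl
[k+1]*[n+1]C[k+1]≡[n+1]*nCk zero    (suc k)
  rewrite k>n⇒nCk≡0 {1} {suc (suc k)} (s≤s (s≤s z≤n)) | k>n⇒nCk≡0 {0} {suc k} (s≤s z≤n) =
  ℕₚ.*-zeroʳ (suc (suc k))
[k+1]*[n+1]C[k+1]≡[n+1]*nCk (suc n) zero
  rewrite nC1≡n (suc (suc n)) = trans (ℕₚ.+-identityʳ _) (sym (ℕₚ.*-identityʳ _))
[k+1]*[n+1]C[k+1]≡[n+1]*nCk (suc n) (suc k) = begin
  (2 ℕ.+ k) ℕ.* (suc (suc n) C suc (suc k))
    ≡⟨ cong ((2 ℕ.+ k) ℕ.*_) (nCk+nC[k+1]≡[n+1]C[k+1] (suc n) (suc k)) ⟨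
  (2 ℕ.+ k) ℕ.* (X ℕ.+ Y)
    ≡⟨ distribute k X Y ⟩
  X ℕ.+ (suc k ℕ.* X ℕ.+ (2 ℕ.+ k) ℕ.* Y)
    ≡⟨ cong (X ℕ.+_) (cong₂ ℕ._+_ ([k+1]*[n+1]C[k+1]≡[n+1]*nCk n k) ([k+1]*[n+1]C[k+1]≡[n+1]*nCk n (suc k))) ⟩
  X ℕ.+ (suc n ℕ.* (n C k) ℕ.+ suc n ℕ.* (n C suc k))
    ≡⟨ cong (X ℕ.+_) (ℕₚ.*-distribˡ-+ (suc n) (n C k) (n C suc k)) ⟨
  X ℕ.+ suc n ℕ.* (n C k ℕ.+ n C suc k)
    ≡⟨ cong (λ t → X ℕ.+ suc n ℕ.* t) (nCk+nC[k+1]≡[n+1]C[k+1] n k) ⟩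
  suc (suc n) ℕ.* X ∎
  where
  open ≡-Reasoning
  X = suc n C suc k
  Y = suc n C suc (suc k)
  distribute : ∀ k X Y → (2 ℕ.+ k) ℕ.* (X ℕ.+ Y) ≡ X ℕ.+ (suc k ℕ.* X ℕ.+ (2 ℕ.+ k) ℕ.* Y)
  distribute = solve-∀

[n+1]*[2n+2]C[n+1]≡[4n+2]*[2n]Cn : ∀ n →
  suc n ℕ.* ((2 ℕ.* suc n) C suc n) ≡ (4 ℕ.* n ℕ.+ 2) ℕ.* ((2 ℕ.* n) C n)
[n+1]*[2n+2]C[n+1]≡[4n+2]*[2n]Cn n = begin
  suc n ℕ.* ((2 ℕ.* suc n) C suc n)              ≡⟨ cong (λ t → suc n ℕ.* (t C suc n)) (2[1+n]≡ n) ⟩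
  suc n ℕ.* (suc (suc (2 ℕ.* n)) C suc n)        ≡⟨ [k+1]*[n+1]C[k+1]≡[n+1]*nCk (suc (2 ℕ.* n)) n ⟩
  suc (suc (2 ℕ.* n)) ℕ.* (suc (2 ℕ.* n) C n)    ≡⟨ cong (suc (suc (2 ℕ.* n)) ℕ.*_) middle-symmetric ⟩
  suc (suc (2 ℕ.* n)) ℕ.* (suc (2 ℕ.* n) C suc n) ≡⟨ cong (ℕ._* (suc (2 ℕ.* n) C suc n)) (2[1+n]≡ n) ⟨
  (2 ℕ.* suc n) ℕ.* (suc (2 ℕ.* n) C suc n)      ≡⟨ ℕₚ.*-assoc 2 (suc n) _ ⟩
  2 ℕ.* (suc n ℕ.* (suc (2 ℕ.* n) C suc n))      ≡⟨ cong (2 ℕ.*_) ([k+1]*[n+1]C[k+1]≡[n+1]*nCk (2 ℕ.* n) n) ⟩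
  2 ℕ.* (suc (2 ℕ.* n) ℕ.* ((2 ℕ.* n) C n))      ≡⟨ ℕₚ.*-assoc 2 (suc (2 ℕ.* n)) _ ⟨
  (2 ℕ.* suc (2 ℕ.* n)) ℕ.* ((2 ℕ.* n) C n)      ≡⟨ cong (ℕ._* ((2 ℕ.* n) C n)) (2[1+2n]≡ n) ⟩
  (4 ℕ.* n ℕ.+ 2) ℕ.* ((2 ℕ.* n) C n)            ∎
  where
  open ≡-Reasoning
  2[1+n]≡ : ∀ n → 2 ℕ.* suc n ≡ suc (suc (2 ℕ.* n))
  2[1+n]≡ = solve-∀
  2[1+2n]≡ : ∀ n → 2 ℕ.* suc (2 ℕ.* n) ≡ 4 ℕ.* n ℕ.+ 2
  2[1+2n]≡ = solve-∀
  1+2n≡[1+n]+n : ∀ n → suc (2 ℕ.* n) ≡ suc n ℕ.+ n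
  1+2n≡[1+n]+n = solve-∀
  middle-symmetric : suc (2 ℕ.* n) C n ≡ suc (2 ℕ.* n) C suc n
  middle-symmetric = trans (nCk≡nC[n∸k] (ℕₚ.m≤n⇒m≤1+n (ℕₚ.m≤m+n n (1 ℕ.* n))))
    (cong (suc (2 ℕ.* n) C_) (trans (cong (_∸ n) (1+2n≡[1+n]+n n)) (ℕₚ.m+n∸n≡m (suc n) n)))

pos-*-distribʳ : ∀ a b x → + a * x + + b * x ≡ + (a ℕ.+ b) * x
pos-*-distribʳ a b x = trans (sym (ℤₚ.*-distribʳ-+ x (+ a) (+ b))) (cong (_* x) (sym (ℤₚ.pos-+ a b)))

module _ (ℓ : ℕ → ℕ) (ℓ-zero : ℓ 0 ≡ 1)
         (ℓ-suc : ∀ n → + ℓ (suc n) ≡ sumTo n (λ k → + ℓ k * + ℓ (n ∸ k))) where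

  private
    W : ℕ → ℕ → ℤ
    W n k = + ℓ k * + ℓ (n ∸ k)

    weighted : ℕ → (ℕ → ℕ) → ℤ
    weighted n g = sumTo n (λ k → + g k * W n k)

    weighted-reverse : ∀ n g → weighted n g ≡ sumTo n (λ k → + g (n ∸ k) * W n k)
    weighted-reverse n g = trans (sumTo-reverse n (λ k → + g k * W n k)) (sumTo-cong n (λ k k≤n →
      cong (+ g (n ∸ k) *_) (trans (cong (λ i → + ℓ (n ∸ k) * + ℓ i) (ℕₚ.m∸[m∸n]≡n k≤n))
                                   (ℤₚ.*-comm (+ ℓ (n ∸ k)) (+ ℓ k)))))

    weighted-symmetric : ∀ n g c → (∀ k → k ≤ n → g k ℕ.+ g (n ∸ k) ≡ c) →
      weighted n g + weighted n g ≡ + c * + ℓ (suc n)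
    weighted-symmetric n g c g+g≡c = begin
      weighted n g + weighted n g
        ≡⟨ cong (λ x → weighted n g + x) (weighted-reverse n g) ⟩
      weighted n g + sumTo n (λ k → + g (n ∸ k) * W n k)
        ≡⟨ sumTo-+ n _ _ ⟨
      sumTo n (λ k → + g k * W n k + + g (n ∸ k) * W n k)
        ≡⟨ sumTo-cong n (λ k k≤n → trans (pos-*-distribʳ (g k) (g (n ∸ k)) (W n k))
                                         (cong (λ w → + w * W n k) (g+g≡c k k≤n))) ⟩
      sumTo n (λ k → + c * W n k)
        ≡⟨ *-distribˡ-sumTo n (+ c) (W n) ⟨
      + c * sumTo n (W n)
        ≡⟨ cong (+ c *_) (ℓ-suc n) ⟨
      + c * + ℓ (suc n) ∎
      where open ≡-Reasoning

    ℓ-one : + ℓ 1 ≡ + ℓ 0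
    ℓ-one = trans (ℓ-suc 0) (subst (λ x → + x * + x ≡ + x) (sym ℓ-zero) refl)

    RatioAt : ℕ → Set
    RatioAt k = + (2 ℕ.+ k) * + ℓ (suc k) ≡ + (4 ℕ.* k ℕ.+ 2) * + ℓ k

    odd : ℕ → ℕ
    odd k = 2 ℕ.* k ℕ.+ 1

    weighted-suc-suc : ∀ n → (∀ k → k ≤ n → RatioAt k) →
      weighted (suc n) suc ≡ + ℓ (suc n) + + (2 ℕ.* n ℕ.+ 2) * + ℓ (suc n)
    weighted-suc-suc n ratio≤n = begin
      weighted (suc n) suc
        ≡⟨ sumTo-suc n (λ k → + suc k * W (suc n) k) ⟩
      + 1 * (+ ℓ 0 * x) + sumTo n (λ k → + (2 ℕ.+ k) * (+ ℓ (suc k) * + ℓ (n ∸ k)))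
        ≡⟨ cong₂ _+_ (trans (ℤₚ.*-identityˡ _) (subst (λ y → + y * x ≡ x) (sym ℓ-zero) (ℤₚ.*-identityˡ x)))
                     (sumTo-cong n term) ⟩
      x + sumTo n (λ k → + odd k * W n k + + odd k * W n k)
        ≡⟨ cong (λ y → x + y) (sumTo-+ n _ _) ⟩
      x + (weighted n odd + weighted n odd)
        ≡⟨ cong (λ y → x + y) (weighted-symmetric n odd (2 ℕ.* n ℕ.+ 2) (λ k k≤n →
             trans (odd+odd≡ k (n ∸ k)) (cong (λ t → 2 ℕ.* t ℕ.+ 2) (ℕₚ.m+[n∸m]≡n k≤n)))) ⟩
      x + + (2 ℕ.* n ℕ.+ 2) * x ∎
      where
      open ≡-Reasoning
      x = + ℓ (suc n)
      4k+2≡ : ∀ k → 4 ℕ.* k ℕ.+ 2 ≡ (2 ℕ.* k ℕ.+ 1) ℕ.+ (2 ℕ.* k ℕ.+ 1)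
      4k+2≡ = solve-∀
      odd+odd≡ : ∀ i j → (2 ℕ.* i ℕ.+ 1) ℕ.+ (2 ℕ.* j ℕ.+ 1) ≡ 2 ℕ.* (i ℕ.+ j) ℕ.+ 2
      odd+odd≡ = solve-∀
      term : ∀ k → k ≤ n → + (2 ℕ.+ k) * (+ ℓ (suc k) * + ℓ (n ∸ k)) ≡ + odd k * W n k + + odd k * W n k
      term k k≤n = begin
        + (2 ℕ.+ k) * (+ ℓ (suc k) * + ℓ (n ∸ k))  ≡⟨ ℤₚ.*-assoc (+ (2 ℕ.+ k)) (+ ℓ (suc k)) (+ ℓ (n ∸ k)) ⟨
        + (2 ℕ.+ k) * + ℓ (suc k) * + ℓ (n ∸ k)    ≡⟨ cong (_* + ℓ (n ∸ k)) (ratio≤n k k≤n) ⟩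
        + (4 ℕ.* k ℕ.+ 2) * + ℓ k * + ℓ (n ∸ k)    ≡⟨ ℤₚ.*-assoc (+ (4 ℕ.* k ℕ.+ 2)) (+ ℓ k) (+ ℓ (n ∸ k)) ⟩
        + (4 ℕ.* k ℕ.+ 2) * W n k                  ≡⟨ cong (λ w → + w * W n k) (4k+2≡ k) ⟩
        + (odd k ℕ.+ odd k) * W n k                ≡⟨ pos-*-distribʳ (odd k) (odd k) (W n k) ⟨
        + odd k * W n k + + odd k * W n k          ∎

    -- Symmetry gives (n+2) ℓ (n+1) = 2 · weighted n suc, and weighted-suc-suc evaluates the right side.
    ratio-step : ∀ n → (∀ {k} → k < n → RatioAt k) → RatioAt n
    ratio-step zero    _  = cong (+ 2 *_) ℓ-one
    ratio-step (suc n) ih = begin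
      + (3 ℕ.+ n) * + ℓ (suc (suc n))
        ≡⟨ weighted-symmetric (suc n) suc (3 ℕ.+ n) (λ k k≤ → cong suc (trans (ℕₚ.+-suc k (suc n ∸ k))
                                                       (cong suc (ℕₚ.m+[n∸m]≡n k≤)))) ⟨
      weighted (suc n) suc + weighted (suc n) suc
        ≡⟨ cong₂ _+_ weighted≡ weighted≡ ⟩
      (x + + c * x) + (x + + c * x)
        ≡⟨ cong₂ _+_ x+cx x+cx ⟩
      + suc c * x + + suc c * x
        ≡⟨ pos-*-distribʳ (suc c) (suc c) x ⟩
      + (suc c ℕ.+ suc c) * x
        ≡⟨ cong (λ w → + w * x) (2[1+c]≡ n) ⟩
      + (4 ℕ.* suc n ℕ.+ 2) * x ∎
      where
      open ≡-Reasoning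
      x = + ℓ (suc n)
      c = 2 ℕ.* n ℕ.+ 2
      weighted≡ = weighted-suc-suc n (λ k k≤n → ih (s≤s k≤n))
      x+cx : x + + c * x ≡ + suc c * x
      x+cx = sym (trans (ℤₚ.*-distribʳ-+ x (+ 1) (+ c)) (cong (_+ + c * x) (ℤₚ.*-identityˡ x)))
      2[1+c]≡ : ∀ n → suc (2 ℕ.* n ℕ.+ 2) ℕ.+ suc (2 ℕ.* n ℕ.+ 2) ≡ 4 ℕ.* suc n ℕ.+ 2
      2[1+c]≡ = solve-∀

    ratio : ∀ n → (2 ℕ.+ n) ℕ.* ℓ (suc n) ≡ (4 ℕ.* n ℕ.+ 2) ℕ.* ℓ n
    ratio n = ℤₚ.+-injective (trans (ℤₚ.pos-* (2 ℕ.+ n) (ℓ (suc n)))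
                (trans (<-rec RatioAt ratio-step n) (sym (ℤₚ.pos-* (4 ℕ.* n ℕ.+ 2) (ℓ n)))))

    [n+1]*ℓn≡[2n]Cn : ∀ n → suc n ℕ.* ℓ n ≡ (2 ℕ.* n) C n
    [n+1]*ℓn≡[2n]Cn zero    = trans (ℕₚ.*-identityˡ (ℓ 0)) ℓ-zero
    [n+1]*ℓn≡[2n]Cn (suc n) = ℕₚ.*-cancelˡ-≡ _ _ (suc n) (begin
      suc n ℕ.* ((2 ℕ.+ n) ℕ.* ℓ (suc n))     ≡⟨ cong (suc n ℕ.*_) (ratio n) ⟩
      suc n ℕ.* ((4 ℕ.* n ℕ.+ 2) ℕ.* ℓ n)     ≡⟨ x[yz]≡y[xz] (suc n) (4 ℕ.* n ℕ.+ 2) (ℓ n) ⟩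
      (4 ℕ.* n ℕ.+ 2) ℕ.* (suc n ℕ.* ℓ n)     ≡⟨ cong ((4 ℕ.* n ℕ.+ 2) ℕ.*_) ([n+1]*ℓn≡[2n]Cn n) ⟩
      (4 ℕ.* n ℕ.+ 2) ℕ.* ((2 ℕ.* n) C n)     ≡⟨ [n+1]*[2n+2]C[n+1]≡[4n+2]*[2n]Cn n ⟨
      suc n ℕ.* ((2 ℕ.* suc n) C suc n)       ∎)
      where
      open ≡-Reasoning
      x[yz]≡y[xz] : ∀ x y z → x ℕ.* (y ℕ.* z) ≡ y ℕ.* (x ℕ.* z)
      x[yz]≡y[xz] = solve-∀

  catalan-unique : ∀ n → ℓ n ≡ catalan n
  catalan-unique n = sym (begin
    ((2 ℕ.* n) C n) / suc n        ≡⟨ cong (_/ suc n) ([n+1]*ℓn≡[2n]Cn n) ⟨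
    (suc n ℕ.* ℓ n) / suc n        ≡⟨ cong (_/ suc n) (ℕₚ.*-comm (suc n) (ℓ n)) ⟩
    (ℓ n ℕ.* suc n) / suc n        ≡⟨ m*n/n≡m (ℓ n) (suc n) ⟩
    ℓ n                            ∎)
    where open ≡-Reasoning

length-S231 : ∀ n → length (S231 n) ≡ catalan n
length-S231 = catalan-unique (λ n → length (S231 n)) refl length-S231-suc

-- Fixed points and excedances

countPositions : (ℕ → ℕ → Bool) → ℕ → List ℕ → ℕ
countPositions r i []       = 0
countPositions r i (v ∷ vs) = (if r i v then 1 else 0) ℕ.+ countPositions r (suc i) vs

fpFrom≡countPositions : ∀ i vs → fpFrom i vs ≡ countPositions (λ i v → v ≡ᵇ i) i vs
fpFrom≡countPositions i []       = refl
fpFrom≡countPositions i (v ∷ vs) = cong ((if v ≡ᵇ i then 1 else 0) ℕ.+_) (fpFrom≡countPositions (suc i) vs)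

excFrom≡countPositions : ∀ i vs → excFrom i vs ≡ countPositions _<ᵇ_ i vs
excFrom≡countPositions i []       = refl
excFrom≡countPositions i (v ∷ vs) = cong ((if i <ᵇ v then 1 else 0) ℕ.+_) (excFrom≡countPositions (suc i) vs)

module _ (r : ℕ → ℕ → Bool) where

  countPositions-++ : ∀ i xs ys →
    countPositions r i (xs ++ ys) ≡ countPositions r i xs ℕ.+ countPositions r (i ℕ.+ length xs) ys
  countPositions-++ i []       ys = cong (λ j → countPositions r j ys) (sym (ℕₚ.+-identityʳ i))
  countPositions-++ i (x ∷ xs) ys =
    trans (cong ((if r i x then 1 else 0) ℕ.+_) (trans (countPositions-++ (suc i) xs ys)
            (cong (λ j → countPositions r (suc i) xs ℕ.+ countPositions r j ys) (sym (ℕₚ.+-suc i (length xs))))))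
          (sym (ℕₚ.+-assoc (if r i x then 1 else 0) _ _))

  countPositions-below : (∀ {i v} → v < i → r i v ≡ false) → ∀ i vs → All (_< i) vs → countPositions r i vs ≡ 0
  countPositions-below r-below i []       []           = refl
  countPositions-below r-below i (v ∷ vs) (v<i ∷ vs<i) rewrite r-below v<i =
    countPositions-below r-below (suc i) vs (All.map ℕₚ.m<n⇒m<1+n vs<i)

  module _ (invariant : ShiftInvariant r) where

    countPositions-shift : ∀ k i vs → countPositions r (k ℕ.+ i) (map (k ℕ.+_) vs) ≡ countPositions r i vs
    countPositions-shift k i []       = refl
    countPositions-shift k i (v ∷ vs) =
      cong₂ (λ b c → (if b then 1 else 0) ℕ.+ c) (invariant k i v)
        (trans (cong (λ j → countPositions r j (map (k ℕ.+_) vs)) (sym (ℕₚ.+-suc k i)))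
               (countPositions-shift k (suc i) vs))

    countPositions-insert : ∀ s m α β →
      countPositions r (suc s) (α ++ length α ℕ.+ suc m ∷ map (length α ℕ.+_) β)
        ≡ ((if r s m then 1 else 0) ℕ.+ countPositions r (suc (suc s)) β) ℕ.+ countPositions r (suc s) α
    countPositions-insert s m α β = begin
      countPositions r (suc s) (α ++ k ℕ.+ suc m ∷ map (k ℕ.+_) β)
        ≡⟨ countPositions-++ (suc s) α _ ⟩
      countPositions r (suc s) α ℕ.+ countPositions r (suc s ℕ.+ k) (k ℕ.+ suc m ∷ map (k ℕ.+_) β)
        ≡⟨ cong (λ j → countPositions r (suc s) α ℕ.+ countPositions r j (k ℕ.+ suc m ∷ map (k ℕ.+_) β))
                (ℕₚ.+-comm (suc s) k) ⟩
      countPositions r (suc s) α ℕ.+ countPositions r (k ℕ.+ suc s) (map (k ℕ.+_) (suc m ∷ β))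
        ≡⟨ cong (countPositions r (suc s) α ℕ.+_) (countPositions-shift k (suc s) (suc m ∷ β)) ⟩
      countPositions r (suc s) α ℕ.+ ((if r (suc s) (suc m) then 1 else 0) ℕ.+ countPositions r (suc (suc s)) β)
        ≡⟨ cong (λ b → countPositions r (suc s) α ℕ.+ ((if b then 1 else 0) ℕ.+ countPositions r (suc (suc s)) β))
                (invariant 1 s m) ⟩
      countPositions r (suc s) α ℕ.+ ((if r s m then 1 else 0) ℕ.+ countPositions r (suc (suc s)) β)
        ≡⟨ ℕₚ.+-comm (countPositions r (suc s) α) _ ⟩
      ((if r s m then 1 else 0) ℕ.+ countPositions r (suc (suc s)) β) ℕ.+ countPositions r (suc s) α ∎
      where
      open ≡-Reasoning
      k = length α

around-as-insert : ∀ {n m} α β → length α ℕ.+ m ≡ n →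
  around (suc n) α β ≡ α ++ length α ℕ.+ suc m ∷ map (length α ℕ.+_) β
around-as-insert {m = m} α β refl = cong (λ x → α ++ x ∷ map (length α ℕ.+_) β) (sym (ℕₚ.+-suc (length α) m))

fpFrom-around : ∀ s {n m} α β → length α ℕ.+ m ≡ n →
  fpFrom (suc s) (around (suc n) α β)
    ≡ ((if m ≡ᵇ s then 1 else 0) ℕ.+ fpFrom (suc (suc s)) β) ℕ.+ fpFrom (suc s) α
fpFrom-around s {n} {m} α β k+m≡n = begin
  fpFrom (suc s) (around _ α β)
    ≡⟨ fpFrom≡countPositions (suc s) (around (suc n) α β) ⟩
  countPositions r (suc s) (around _ α β)
    ≡⟨ cong (countPositions r (suc s)) (around-as-insert α β k+m≡n) ⟩
  countPositions r (suc s) (α ++ length α ℕ.+ suc m ∷ map (length α ℕ.+_) β)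
    ≡⟨ countPositions-insert r ≡ᵇ-shiftInvariant s m α β ⟩
  ((if m ≡ᵇ s then 1 else 0) ℕ.+ countPositions r (suc (suc s)) β) ℕ.+ countPositions r (suc s) α
    ≡⟨ cong₂ (λ x y → ((if m ≡ᵇ s then 1 else 0) ℕ.+ x) ℕ.+ y)
             (fpFrom≡countPositions (suc (suc s)) β) (fpFrom≡countPositions (suc s) α) ⟨
  ((if m ≡ᵇ s then 1 else 0) ℕ.+ fpFrom (suc (suc s)) β) ℕ.+ fpFrom (suc s) α ∎
  where
  open ≡-Reasoning
  r = λ i v → v ≡ᵇ i

excFrom-around : ∀ s {n m} α β → length α ℕ.+ m ≡ n →
  excFrom (suc s) (around (suc n) α β)
    ≡ ((if s <ᵇ m then 1 else 0) ℕ.+ excFrom (suc (suc s)) β) ℕ.+ excFrom (suc s) α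
excFrom-around s {n} {m} α β k+m≡n = begin
  excFrom (suc s) (around _ α β)
    ≡⟨ excFrom≡countPositions (suc s) (around (suc n) α β) ⟩
  countPositions _<ᵇ_ (suc s) (around _ α β)
    ≡⟨ cong (countPositions _<ᵇ_ (suc s)) (around-as-insert α β k+m≡n) ⟩
  countPositions _<ᵇ_ (suc s) (α ++ length α ℕ.+ suc m ∷ map (length α ℕ.+_) β)
    ≡⟨ countPositions-insert _<ᵇ_ <ᵇ-shiftInvariant s m α β ⟩
  ((if s <ᵇ m then 1 else 0) ℕ.+ countPositions _<ᵇ_ (suc (suc s)) β) ℕ.+ countPositions _<ᵇ_ (suc s) α
    ≡⟨ cong₂ (λ x y → ((if s <ᵇ m then 1 else 0) ℕ.+ x) ℕ.+ y)
             (excFrom≡countPositions (suc (suc s)) β) (excFrom≡countPositions (suc s) α) ⟨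
  ((if s <ᵇ m then 1 else 0) ℕ.+ excFrom (suc (suc s)) β) ℕ.+ excFrom (suc s) α ∎
  where open ≡-Reasoning

-- shiftedF231 s is G_s: fixed points π_i = i + s and excedances π_i > i + s.
shiftedF231 : ℕ → Series
shiftedF231 s n = statGF (fpFrom (suc s)) (excFrom (suc s)) (S231 n)

blockFp blockExc : ℕ → ℕ → List ℕ → ℕ
blockFp  s m β = (if m ≡ᵇ s then 1 else 0) ℕ.+ fpFrom (suc (suc s)) β
blockExc s m β = (if s <ᵇ m then 1 else 0) ℕ.+ excFrom (suc (suc s)) β

blockGF : ℕ → ℕ → ℕ → ℕ → ℤ
blockGF s m = statGF (blockFp s m) (blockExc s m) (S231 m)

S231-stats-vanish : ∀ {m s π} → m ≤ s → π ∈ S231 m → fpFrom (suc (suc s)) π ≡ 0 × excFrom (suc (suc s)) π ≡ 0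
S231-stats-vanish {m} {s} {π} m≤s π∈ =
  trans (fpFrom≡countPositions _ π) (countPositions-below _ (λ v<i → ≡ᵇ-false (ℕₚ.<⇒≢ v<i)) _ π π<2+s) ,
  trans (excFrom≡countPositions _ π) (countPositions-below _ (<ᵇ-false ∘ ℕₚ.<⇒≤) _ π π<2+s)
  where
  π<2+s : All (_< suc (suc s)) π
  π<2+s = All.tabulate (λ x∈ → s≤s (ℕₚ.m≤n⇒m≤1+n (ℕₚ.≤-trans (proj₂ (∈-S231-entry π∈ x∈)) m≤s)))

shiftedF231-small : ∀ {m s} → m ≤ s → ∀ j l → shiftedF231 (suc s) m j l ≡ monomial 0 0 j l * + catalan m
shiftedF231-small {m} m≤s j l =
  trans (statGF-const _ _ (S231 m) (λ π∈ → proj₁ (S231-stats-vanish m≤s π∈))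
                                   (λ π∈ → proj₂ (S231-stats-vanish m≤s π∈)) j l)
        (cong (λ c → monomial 0 0 j l * + c) (length-S231 m))

blockGF-below : ∀ {m s} → m < s → ∀ j l → blockGF s m j l ≡ monomial 0 0 j l * + catalan m
blockGF-below {m} {s} m<s j l =
  trans (statGF-const _ _ (S231 m)
          (λ π∈ → cong₂ (λ b n → (if b then 1 else 0) ℕ.+ n) (≡ᵇ-false (ℕₚ.<⇒≢ m<s)) (proj₁ (vanish π∈)))
          (λ π∈ → cong₂ (λ b n → (if b then 1 else 0) ℕ.+ n) (<ᵇ-false (ℕₚ.<⇒≤ m<s)) (proj₂ (vanish π∈))) j l)
        (cong (λ c → monomial 0 0 j l * + c) (length-S231 m))
  where
  vanish : ∀ {π} → π ∈ S231 m → fpFrom (suc (suc s)) π ≡ 0 × excFrom (suc (suc s)) π ≡ 0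
  vanish = S231-stats-vanish (ℕₚ.<⇒≤ m<s)

blockGF-equal : ∀ m j l → blockGF m m j l ≡ monomial 1 0 j l * + catalan m
blockGF-equal m j l =
  trans (statGF-const _ _ (S231 m)
          (λ π∈ → cong₂ (λ b n → (if b then 1 else 0) ℕ.+ n) (≡ᵇ-refl m) (proj₁ (vanish π∈)))
          (λ π∈ → cong₂ (λ b n → (if b then 1 else 0) ℕ.+ n) (<ᵇ-false (ℕₚ.≤-refl {m})) (proj₂ (vanish π∈))) j l)
        (cong (λ c → monomial 1 0 j l * + c) (length-S231 m))
  where
  vanish : ∀ {π} → π ∈ S231 m → fpFrom (suc (suc m)) π ≡ 0 × excFrom (suc (suc m)) π ≡ 0
  vanish = S231-stats-vanish ℕₚ.≤-refl

blockGF-above : ∀ {m s} → s < m → ∀ j l → blockGF s m j l ≡ qS (shiftedF231 (suc s)) m j l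
blockGF-above {m} {s} s<m j l
  rewrite ≡ᵇ-false (ℕₚ.>⇒≢ s<m) | <ᵇ-true s<m with l
... | suc l = refl
... | zero  = cong +_ (trans (countᵇ-cong (S231 m) (λ {π} _ → ∧-zeroʳ (fpFrom (suc (suc s)) π ≡ᵇ j)))
                             (countᵇ-const false (S231 m)))

m<1+m+k : ∀ m k → m < suc (m ℕ.+ k)
m<1+m+k m k = s≤s (ℕₚ.m≤m+n m k)

shiftedF231-constant : ∀ {m s} → m ≤ s → shiftedF231 (suc s) m 0 0 ≡ + catalan m
shiftedF231-constant m≤s = trans (shiftedF231-small m≤s 0 0) (ℤₚ.*-identityˡ _)

-C+C≡0 : ∀ {C x} → x ≡ C → - C + x ≡ 0ℤ
-C+C≡0 {C} refl = ℤₚ.+-inverseˡ C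

-- For m ≤ s only the maximum can contribute, giving C_m or x C_m; for m > s it is an excedance.
-- K'_s m is what remains after subtracting q shiftedF231 (suc s) m.
blockGF≡K'+qS : ∀ s m j l → blockGF s m j l ≡ K' s m j l + qS (shiftedF231 (suc s)) m j l
blockGF≡K'+qS s m j l with ℕ.compare m s
blockGF≡K'+qS _ m 0             0             | ℕ.less _ k =
  trans (blockGF-below (m<1+m+k m k) 0 0) (trans (ℤₚ.*-identityˡ _) (sym (ℤₚ.+-identityʳ _)))
blockGF≡K'+qS _ m 0             1             | ℕ.less _ k =
  trans (blockGF-below (m<1+m+k m k) 0 1) (sym (-C+C≡0 (shiftedF231-constant (ℕₚ.<⇒≤ (m<1+m+k m k)))))
blockGF≡K'+qS _ m 0             (suc (suc l)) | ℕ.less _ k =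
  trans (blockGF-below (m<1+m+k m k) 0 (suc (suc l)))
        (sym (trans (ℤₚ.+-identityˡ _) (shiftedF231-small (ℕₚ.<⇒≤ (m<1+m+k m k)) 0 (suc l))))
blockGF≡K'+qS _ m (suc j)       0             | ℕ.less _ k = blockGF-below (m<1+m+k m k) (suc j) 0
blockGF≡K'+qS _ m (suc j)       (suc l)       | ℕ.less _ k =
  trans (blockGF-below (m<1+m+k m k) (suc j) (suc l))
        (sym (trans (ℤₚ.+-identityˡ _) (shiftedF231-small (ℕₚ.<⇒≤ (m<1+m+k m k)) (suc j) l)))
blockGF≡K'+qS _ m 0             0             | ℕ.equal _ = blockGF-equal m 0 0
blockGF≡K'+qS _ m 0             1             | ℕ.equal _ =
  trans (blockGF-equal m 0 1) (sym (-C+C≡0 (shiftedF231-constant (ℕₚ.≤-refl {m}))))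
blockGF≡K'+qS _ m 0             (suc (suc l)) | ℕ.equal _ =
  trans (blockGF-equal m 0 (suc (suc l)))
        (sym (trans (ℤₚ.+-identityˡ _) (shiftedF231-small (ℕₚ.≤-refl {m}) 0 (suc l))))
blockGF≡K'+qS _ m 1             0             | ℕ.equal _ =
  trans (blockGF-equal m 1 0) (trans (ℤₚ.*-identityˡ _) (sym (ℤₚ.+-identityʳ _)))
blockGF≡K'+qS _ m 1             (suc l)       | ℕ.equal _ =
  trans (blockGF-equal m 1 (suc l)) (sym (trans (ℤₚ.+-identityˡ _) (shiftedF231-small (ℕₚ.≤-refl {m}) 1 l)))
blockGF≡K'+qS _ m (suc (suc j)) 0             | ℕ.equal _ = blockGF-equal m (suc (suc j)) 0
blockGF≡K'+qS _ m (suc (suc j)) (suc l)       | ℕ.equal _ =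
  trans (blockGF-equal m (suc (suc j)) (suc l))
        (sym (trans (ℤₚ.+-identityˡ _) (shiftedF231-small (ℕₚ.≤-refl {m}) (suc (suc j)) l)))
blockGF≡K'+qS s _ j             l             | ℕ.greater _ k =
  trans (blockGF-above (m<1+m+k s k) j l) (sym (ℤₚ.+-identityˡ _))

shiftedF231-zero : ∀ s a b → shiftedF231 s 0 a b ≡ oneS 0 a b
shiftedF231-zero s zero    zero    = refl
shiftedF231-zero s zero    (suc b) = refl
shiftedF231-zero s (suc a) b       = refl

blocks-GF : ∀ s {n m} → m ≤ n → ∀ a b →
  statGF (fpFrom (suc s)) (excFrom (suc s)) (blocks n m) a b ≡ (blockGF s m ✶ shiftedF231 s (n ∸ m)) a b
blocks-GF s {n} {m} m≤n = statGF-product (fpFrom (suc s)) (excFrom (suc s)) (blockFp s m) (blockExc s m)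
  (fpFrom (suc s)) (excFrom (suc s)) (λ β α → around (suc n) α β) (S231 m) (S231 (n ∸ m))
  (λ {β} {α} _ α∈ → let k+m≡n = trans (cong (ℕ._+ m) (∈-S231⇒length α∈)) (ℕₚ.m∸n+n≡m m≤n)
                    in fpFrom-around s α β k+m≡n , excFrom-around s α β k+m≡n)

shiftedF231-unfold : ∀ s n a b →
  shiftedF231 s n a b ≡ oneS n a b + (cf-term s (shiftedF231 (suc s)) ⊗ shiftedF231 s) n a b
shiftedF231-unfold s zero a b = begin
  shiftedF231 s 0 a b                     ≡⟨ shiftedF231-zero s a b ⟩
  oneS 0 a b                              ≡⟨ ℤₚ.+-identityʳ _ ⟨
  oneS 0 a b + 0ℤ                         ≡⟨ cong (λ x → oneS 0 a b + x)
                                               (⊗-noConstantˡ-zero f (shiftedF231 s) (λ _ _ → refl) a b) ⟨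
  oneS 0 a b + (f ⊗ shiftedF231 s) 0 a b  ∎
  where
  open ≡-Reasoning
  f = cf-term s (shiftedF231 (suc s))
shiftedF231-unfold s (suc n) a b = begin
  shiftedF231 s (suc n) a b
    ≡⟨ statGF-S231-suc (fpFrom (suc s)) (excFrom (suc s)) n a b ⟩
  sumTo n (λ m → statGF (fpFrom (suc s)) (excFrom (suc s)) (blocks n m) a b)
    ≡⟨ sumTo-cong n (λ m m≤n → trans (blocks-GF s m≤n a b)
                                      (✶-congˡ (shiftedF231 s (n ∸ m)) (blockGF≡K'+qS s m) a b)) ⟩
  sumTo n (λ m → (f (suc m) ✶ shiftedF231 s (n ∸ m)) a b)
    ≡⟨ ⊗-noConstantˡ-suc f (shiftedF231 s) (λ _ _ → refl) n a b ⟨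
  (f ⊗ shiftedF231 s) (suc n) a b
    ≡⟨ ℤₚ.+-identityˡ _ ⟨
  oneS (suc n) a b + (f ⊗ shiftedF231 s) (suc n) a b ∎
  where
  open ≡-Reasoning
  f = cf-term s (shiftedF231 (suc s))

corollary3p9 : (d n a b : ℕ) → n < d → F231 n a b ≡ CF d 0 n a b
corollary3p9 d n a b n<d = CF-agrees shiftedF231 shiftedF231-unfold n d 0 a b (ℕₚ.<⇒≤ n<d)
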